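{- Let $A=(A_m)_{m\ge3}$ be any fixed (deterministic) evolving cycle and let $B$ be a random evolving cycle. For $n\ge4$ let $I_n$ be the event that $n$ is a vertex of the pedigree graph $G^{AB}_n$ and is isolated in $G^{AB}_n$, and let $Y=\sum_{n\ge4}\mathbf 1_{I_n}$. Then $\mathbb E\,Y=2$. Moreover, for every $\varepsilon>0$, if $n_0\ge 4/\varepsilon+2$, then $$\Pr\Bigl(\bigcup_{n\ge n_0} I_n\Bigr)\le\varepsilon .$$
   Context: For $m\ge 3$, a cycle on $[m]=\{1,\dots,m\}$ is an undirected Hamiltonian cycle with node set $[m]$; its edges are cycle-edges. An evolving cycle is a sequence $A=(A_m)_{m\ge3}$ where $A_3$ is the unique cycle on $\{1,2,3\}$ and, for $m\ge4$, $A_m$ is obtained from $A_{m-1}$ by inserting the new node $m$ into (subdividing) one cycle-edge of $A_{m-1}$. For $m\ge4$, $\nu_A(m)$ is the set of the two neighbours of $m$ in $A_m$ (the cycle-edge of $A_{m-1}$ into which $m$ was inserted); $\nu_A(3)=\{1,2\}$, $\nu_A(2)=\{1\}$, $\nu_A(1)=\emptyset$. A random evolving cycle $B$ is obtained by inserting, for each $m\ge4$, node $m$ into a cycle-edge of $B_{m-1}$ chosen uniformly at random, independently of all other choices. The pedigree graph $G^{AB}_n$ ($n\ge3$) has vertex set $\{m\in\{4,\dots,n\}:\nu_A(m)\neq\nu_B(m)\}$, and for vertices $k<m$ of it, $\{k,m\}$ is an edge iff at least one holds: (i) $\nu_A(m)=\nu_B(k)$; (ii) $\nu_B(m)=\nu_A(k)$;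 (iii) $k=\max\nu_A(m)$ and $\nu_B(k)\cap\nu_A(m)=\emptyset$; (iv) $k=\max\nu_B(m)$ and $\nu_A(k)\cap\nu_B(m)=\emptyset$.
   Formalization: The parameter ε ranges over the positive rationals. -}

module Defs where

open import Data.Nat as ℕ using (ℕ; zero; suc; _+_; _∸_; _≤ᵇ_; _≡ᵇ_)
open import Data.Fin using (Fin; toℕ)
open import Data.Bool using (Bool; true; false; _∧_; _∨_; not; if_then_else_)
open import Data.List using (List; []; _∷_; map; length; upTo; concatMap; foldr; _++_; [_])
open import Data.Product using (_×_; _,_)
open import Data.Integer using (+_)
open import Data.Rational using (ℚ; 0ℚ; _/_; _÷_; _<_; >-nonZero)
import Data.Rational as ℚ

-- A sequence of insertion choices: the node m = 4 + k is inserted into the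
-- cycle-edge with index f k of the current cycle (which has 3 + k edges).
-- An evolving cycle is a choice sequence with f k < 3 + k; this encoding is
-- a bijection between evolving cycles and such sequences.
EvolvingCycle : Set
EvolvingCycle = (k : ℕ) → Fin (3 + k)

-- A cycle is stored as the list of its nodes in cyclic order; the cycle-edge
-- with index i joins the nodes at positions i and i+1 (mod length).
nthD : List ℕ → ℕ → ℕ
nthD []       _       = 0
nthD (x ∷ _)  zero    = x
nthD (_ ∷ xs) (suc i) = nthD xs i

insertAt : ℕ → ℕ → List ℕ → List ℕ
insertAt zero    x l        = x ∷ l
insertAt (suc p) x []       = x ∷ []
insertAt (suc p) x (y ∷ l)  = y ∷ insertAt p x l

-- cycAux f j : the cycle A_{3+j} after j insertions (nodes 4, …, 3+j)
cycAux : (ℕ → ℕ) → ℕ → List ℕ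
cycAux f zero    = 1 ∷ 2 ∷ 3 ∷ []
cycAux f (suc j) = insertAt (suc (f j)) (4 + j) (cycAux f j)

cycleAt : (ℕ → ℕ) → ℕ → List ℕ
cycleAt f m = cycAux f (m ∸ 3)

edgeEnds : List ℕ → ℕ → ℕ × ℕ
edgeEnds c i =
  let a = nthD c i
      b = if suc i ≡ᵇ length c then nthD c 0 else nthD c (suc i)
  in (ℕ._⊓_ a b , ℕ._⊔_ a b)

-- ν(m) for m ≥ 4: the cycle-edge of A_{m-1} into which m was inserted
-- (a 2-element set, represented as the sorted pair of its elements)
nu : (ℕ → ℕ) → ℕ → ℕ × ℕ
nu f m = edgeEnds (cycleAt f (m ∸ 1)) (f (m ∸ 4))

maxPair : ℕ × ℕ → ℕ
maxPair (_ , b) = b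

eqPair : ℕ × ℕ → ℕ × ℕ → Bool
eqPair (a , b) (c , d) = (a ≡ᵇ c) ∧ (b ≡ᵇ d)

disjointPair : ℕ × ℕ → ℕ × ℕ → Bool
disjointPair (a , b) (c , d) =
  not ((a ≡ᵇ c) ∨ (a ≡ᵇ d) ∨ (b ≡ᵇ c) ∨ (b ≡ᵇ d))

-- m is a vertex of the pedigree graph (any G^{AB}_n with n ≥ m)
isVertex : (ℕ → ℕ) → (ℕ → ℕ) → ℕ → Bool
isVertex f g m = (4 ≤ᵇ m) ∧ not (eqPair (nu f m) (nu g m))

-- edge condition (i)–(iv) for vertices k < m
isEdge : (ℕ → ℕ) → (ℕ → ℕ) → ℕ → ℕ → Bool
isEdge f g k m =
     eqPair (nu f m) (nu g k)
  ∨  eqPair (nu g m) (nu f k)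
  ∨ ((k ≡ᵇ maxPair (nu f m)) ∧ disjointPair (nu g k) (nu f m))
  ∨ ((k ≡ᵇ maxPair (nu g m)) ∧ disjointPair (nu f k) (nu g m))

allB : List Bool → Bool
allB = foldr _∧_ true

anyB : List Bool → Bool
anyB = foldr _∨_ false

isolatedEvent : (ℕ → ℕ) → (ℕ → ℕ) → ℕ → Bool
isolatedEvent f g n =
  isVertex f g n ∧
  allB (map (λ k → not (isVertex f g k ∧ isEdge f g k n)) (upTo n))

choices : EvolvingCycle → ℕ → ℕ
choices A k = toℕ (A k)

-- all possible first j choices of a random evolving cycle
-- (entry k ranges over 0 … 2+k); each prefix has the same probability
prefixes : ℕ → List (List ℕ)
prefixes zero    = [] ∷ []
prefixes (suc j) = concatMap (λ p → map (λ i → p ++ [ i ]) (upTo (3 + j))) (prefixes j)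

countTrue : List Bool → ℕ
countTrue = foldr (λ b n → if b then suc n else n) 0

frac : ℕ → ℕ → ℚ
frac a zero    = 0ℚ
frac a (suc d) = + a / suc d

-- probability (under the uniform law of the random evolving cycle B) of an
-- event depending only on the first j insertion choices of B
probPrefix : ℕ → ((ℕ → ℕ) → Bool) → ℚ
probPrefix j E =
  frac (countTrue (map (λ p → E (nthD p)) (prefixes j))) (length (prefixes j))

-- Pr(I_n)  (I_n depends only on B_n, i.e. the first n ∸ 3 choices)
probI : EvolvingCycle → ℕ → ℚ
probI A n = probPrefix (n ∸ 3) (λ g → isolatedEvent (choices A) g n)

-- Σ_{n=4}^{N} Pr(I_n)  = E (Σ_{n=4}^{N} 1_{I_n})
partialEY : EvolvingCycle → ℕ → ℚ
partialEY A N =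
  foldr ℚ._+_ 0ℚ (map (λ n → if 4 ≤ᵇ n then probI A n else 0ℚ) (upTo (suc N)))

probUnion : EvolvingCycle → ℕ → ℕ → ℚ
probUnion A n₀ N =
  probPrefix (N ∸ 3)
    (λ g → anyB (map (λ n → (4 ≤ᵇ n) ∧ (n₀ ≤ᵇ n) ∧ isolatedEvent (choices A) g n)
                     (upTo (suc N))))

threshold : (ε : ℚ) → 0ℚ < ε → ℚ
threshold ε p = ℚ._+_ (_÷_ (+ 4 / 1) ε {{>-nonZero p}}) (+ 2 / 1)

-- Write n = j + 4 and let ν_A, ν_B be the edges into which n is inserted. An edge of A_{n-1}
-- is still an edge of B_{n-1} unless some earlier insertion on which A and B differ subdivided
-- it or created it, and these are exactly the edge conditions (i) and (iii); hence I_n holds iff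
-- ν_A ≠ ν_B, ν_A is an edge of B_{n-1} and ν_B is an edge of A_{n-1}. Over the (j+3)!/2 equally
-- likely histories B_{n-1}, a fixed edge of the cycle on j + 3 nodes occurs in (j+1)! of them and
-- two distinct edges e, f together in (2 - s) j! of them, s being their number of common
-- endpoints; as every node has degree 2, summing over the j + 2 edges e ≠ ν_A of A_{n-1} gives
-- Pr(I_n) = 4 / ((n-1)(n-2)) = 4/(n-2) - 4/(n-1). The series telescopes: it sums to 2, and its
-- tail from n₀ on is at most 4/(n₀-2) ≤ ε.

module Submission where

open import Defs
open import Algebra.Properties.CommutativeSemigroup using (interchange; x∙yz≈y∙xz)
open import Data.Bool using (Bool; true; false; _∧_; _∨_; not; if_then_else_)
open import Data.Bool.Properties as Bool using (T-≡; ¬-not; ∧-conicalˡ; ∧-conicalʳ; ∧-identityʳ; ∧-zeroʳ; ∨-zeroʳ)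
open import Data.List using (List; []; _∷_; map; length; foldr; upTo; applyUpTo; _++_; [_]; take; drop; concatMap)
open import Data.List.Properties using (map-++; map-∘; length-++; length-upTo; upTo-∷ʳ; map-applyUpTo)
open import Data.Nat.ListAction using (sum)
open import Data.Nat.ListAction.Properties using (sum-++)
open import Data.List.Relation.Unary.All as All using (All; []; _∷_)
open import Data.List.Relation.Unary.All.Properties using (++⁺; concat⁺; map⁺; take⁺; drop⁺; all⁺; all⁻; applyUpTo⁺₁; applyUpTo⁻)
open import Data.Nat using (ℕ; zero; suc; NonZero; ≢-nonZero; _+_; _*_; _!; _∸_; _≤_; _<_; _≡ᵇ_; _≤ᵇ_; _⊓_; _⊔_; z≤n; s≤s)
open import Data.Nat.Properties
open import Data.Nat.Tactic.RingSolver using (solve-∀)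
open import Data.Product using (_×_; _,_; proj₁; proj₂; Σ; ∃-syntax)
open import Data.Sum using (_⊎_; inj₁; inj₂)
open import Function using (Equivalence)
open import Relation.Nullary using (Dec; contradiction; yes; no)
open import Relation.Binary.Definitions using (tri<; tri≈; tri>)
open import Data.Fin.Properties using (toℕ<n)
import Data.Integer as ℤ
import Data.Integer.Properties as ℤ
open import Data.Rational using (ℚ; 0ℚ; _/_; _÷_; _-_; ∣_∣)
open import Data.Rational using () renaming (_<_ to _<ℚ_; _≤_ to _≤ℚ_)
import Data.Rational as ℚ
import Data.Rational.Properties as ℚ
import Data.Rational.Unnormalised as ℚᵘ
import Data.Rational.Unnormalised.Properties as ℚᵘ
open import Relation.Binary.PropositionalEquality hiding ([_]; J)

open Equivalence using (to; from)

∑ : {A : Set} → (A → ℕ) → List A → ℕ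
∑ f xs = sum (map f xs)

module _ {A : Set} where

  ∑-++ : ∀ (f : A → ℕ) xs ys → ∑ f (xs ++ ys) ≡ ∑ f xs + ∑ f ys
  ∑-++ f xs ys = trans (cong sum (map-++ f xs ys)) (sum-++ (map f xs) (map f ys))

  ∑-cong : ∀ {f g : A → ℕ} xs → (∀ x → f x ≡ g x) → ∑ f xs ≡ ∑ g xs
  ∑-cong []       f≗g = refl
  ∑-cong (x ∷ xs) f≗g = cong₂ _+_ (f≗g x) (∑-cong xs f≗g)

  ∑-congᴬ : ∀ {P : A → Set} {f g : A → ℕ} {xs} → All P xs → (∀ x → P x → f x ≡ g x) → ∑ f xs ≡ ∑ g xs
  ∑-congᴬ []                    f≗g = refl
  ∑-congᴬ {xs = x ∷ _} (px ∷ pxs) f≗g = cong₂ _+_ (f≗g x px) (∑-congᴬ pxs f≗g)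

  ∑-+ : ∀ (f g : A → ℕ) xs → ∑ (λ x → f x + g x) xs ≡ ∑ f xs + ∑ g xs
  ∑-+ f g []       = refl
  ∑-+ f g (x ∷ xs) = trans (cong (f x + g x +_) (∑-+ f g xs))
                           (interchange +-commutativeSemigroup (f x) (g x) (∑ f xs) (∑ g xs))

  ∑-*ˡ : ∀ k (f : A → ℕ) xs → ∑ (λ x → k * f x) xs ≡ k * ∑ f xs
  ∑-*ˡ k f []       = sym (*-zeroʳ k)
  ∑-*ˡ k f (x ∷ xs) = trans (cong (k * f x +_) (∑-*ˡ k f xs)) (sym (*-distribˡ-+ k (f x) (∑ f xs)))

  ∑-const : ∀ k (xs : List A) → ∑ (λ _ → k) xs ≡ k * length xs
  ∑-const k []       = sym (*-zeroʳ k)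
  ∑-const k (x ∷ xs) = trans (cong (k +_) (∑-const k xs)) (sym (*-suc k (length xs)))

  ∑-mono : ∀ {f g : A → ℕ} xs → (∀ x → f x ≤ g x) → ∑ f xs ≤ ∑ g xs
  ∑-mono []       f≤g = z≤n
  ∑-mono (x ∷ xs) f≤g = +-mono-≤ (f≤g x) (∑-mono xs f≤g)

∑-swap : ∀ {A B : Set} (K : A → B → ℕ) xs ys →
  ∑ (λ x → ∑ (K x) ys) xs ≡ ∑ (λ y → ∑ (λ x → K x y) xs) ys
∑-swap K []       ys = sym (∑-const 0 ys)
∑-swap K (x ∷ xs) ys = trans (cong (∑ (K x) ys +_) (∑-swap K xs ys))
                             (sym (∑-+ (K x) (λ y → ∑ (λ x → K x y) xs) ys))

∑-upTo-suc : ∀ (f : ℕ → ℕ) n → ∑ f (upTo (suc n)) ≡ ∑ f (upTo n) + f n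
∑-upTo-suc f n = trans (cong (∑ f) (sym (upTo-∷ʳ n)))
                       (trans (∑-++ f (upTo n) [ n ]) (cong (∑ f (upTo n) +_) (+-identityʳ (f n))))

∑-applyUpTo-cong : ∀ {f g : ℕ → ℕ} h n → (∀ i → i < n → f (h i) ≡ g (h i)) →
  ∑ f (applyUpTo h n) ≡ ∑ g (applyUpTo h n)
∑-applyUpTo-cong h zero    f≗g = refl
∑-applyUpTo-cong h (suc n) f≗g =
  cong₂ _+_ (f≗g 0 (s≤s z≤n)) (∑-applyUpTo-cong (λ i → h (suc i)) n (λ i i<n → f≗g (suc i) (s≤s i<n)))

∑-upTo-cong : ∀ {f g : ℕ → ℕ} n → (∀ i → i < n → f i ≡ g i) → ∑ f (upTo n) ≡ ∑ g (upTo n)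
∑-upTo-cong = ∑-applyUpTo-cong (λ i → i)

*-comm-middle : ∀ x y z → x * (y * z) ≡ y * (x * z)
*-comm-middle = x∙yz≈y∙xz *-commutativeSemigroup

𝟙 : Bool → ℕ
𝟙 true  = 1
𝟙 false = 0

𝟙≤1 : ∀ b → 𝟙 b ≤ 1
𝟙≤1 true  = ≤-refl
𝟙≤1 false = z≤n

𝟙-∧ : ∀ x y → 𝟙 (x ∧ y) ≡ 𝟙 x * 𝟙 y
𝟙-∧ true  y = sym (+-identityʳ (𝟙 y))
𝟙-∧ false y = refl

𝟙-not : ∀ x → 𝟙 (not x) + 𝟙 x ≡ 1
𝟙-not true  = refl
𝟙-not false = refl

∧-intro : ∀ {x y} → x ≡ true → y ≡ true → (x ∧ y) ≡ true
∧-intro refl refl = refl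

≡ᵇ-refl : ∀ a → (a ≡ᵇ a) ≡ true
≡ᵇ-refl a = to T-≡ (≡⇒≡ᵇ a a refl)

≡ᵇ-true⇒≡ : ∀ a b → (a ≡ᵇ b) ≡ true → a ≡ b
≡ᵇ-true⇒≡ a b h = ≡ᵇ⇒≡ a b (from T-≡ h)

≢⇒≡ᵇ-false : ∀ a b → a ≢ b → (a ≡ᵇ b) ≡ false
≢⇒≡ᵇ-false a b a≢b with a ≡ᵇ b in h
... | true  = contradiction (≡ᵇ-true⇒≡ a b h) a≢b
... | false = refl

≡ᵇ-sym : ∀ a b → (a ≡ᵇ b) ≡ (b ≡ᵇ a)
≡ᵇ-sym zero    zero    = refl
≡ᵇ-sym zero    (suc b) = refl
≡ᵇ-sym (suc a) zero    = refl
≡ᵇ-sym (suc a) (suc b) = ≡ᵇ-sym a b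

eqPair-true⇒≡ : ∀ e f → eqPair e f ≡ true → e ≡ f
eqPair-true⇒≡ (a , b) (c , d) h =
  cong₂ _,_ (≡ᵇ-true⇒≡ a c (∧-conicalˡ _ _ h)) (≡ᵇ-true⇒≡ b d (∧-conicalʳ _ _ h))

eqPair-refl : ∀ e → eqPair e e ≡ true
eqPair-refl (a , b) rewrite ≡ᵇ-refl a | ≡ᵇ-refl b = refl

≢⇒eqPair-false : ∀ e f → e ≢ f → eqPair e f ≡ false
≢⇒eqPair-false e f e≢f with eqPair e f in h
... | true  = contradiction (eqPair-true⇒≡ e f h) e≢f
... | false = refl

eqPair-sym : ∀ e f → eqPair e f ≡ eqPair f e
eqPair-sym (a , b) (c , d) rewrite ≡ᵇ-sym a c | ≡ᵇ-sym b d = refl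

-- The edges of an evolving cycle

Edge : Set
Edge = ℕ × ℕ

edge : ℕ → ℕ → Edge
edge a b = (a ⊓ b , a ⊔ b)

pathEdges : ℕ → ℕ → List ℕ → List Edge
pathEdges h y []      = edge y h ∷ []
pathEdges h y (z ∷ r) = edge y z ∷ pathEdges h z r

cycleEdges : List ℕ → List Edge
cycleEdges []      = []
cycleEdges (h ∷ t) = pathEdges h h t

edgeAt : List Edge → ℕ → Edge
edgeAt []      _       = (0 , 0)
edgeAt (e ∷ _) zero    = e
edgeAt (_ ∷ L) (suc i) = edgeAt L i

length-pathEdges : ∀ h y r → length (pathEdges h y r) ≡ suc (length r)
length-pathEdges h y []      = refl
length-pathEdges h y (z ∷ r) = cong suc (length-pathEdges h z r)

edgeAt-pathEdges : ∀ h y r i → i ≤ length r →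
  edgeAt (pathEdges h y r) i ≡
  edge (nthD (y ∷ r) i) (if suc i ≡ᵇ suc (length r) then h else nthD (y ∷ r) (suc i))
edgeAt-pathEdges h y []      zero    _         = refl
edgeAt-pathEdges h y (z ∷ r) zero    _         = refl
edgeAt-pathEdges h y (z ∷ r) (suc i) (s≤s i≤r) = edgeAt-pathEdges h z r i i≤r

pathEdges-insertAt : ∀ h y r i x → i ≤ length r → Σ ℕ λ u → Σ ℕ λ v →
  edgeAt (pathEdges h y r) i ≡ edge u v ×
  pathEdges h y (insertAt i x r) ≡
    take i (pathEdges h y r) ++ edge u x ∷ edge x v ∷ drop (suc i) (pathEdges h y r)
pathEdges-insertAt h y []      zero    x _         = y , h , refl , refl
pathEdges-insertAt h y (z ∷ r) zero    x _         = y , z , refl , refl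
pathEdges-insertAt h y (z ∷ r) (suc i) x (s≤s i≤r) with pathEdges-insertAt h z r i x i≤r
... | u , v , uv , ins = u , v , uv , cong (edge y z ∷_) ins

length-insertAt : ∀ i x l → length (insertAt i x l) ≡ suc (length l)
length-insertAt zero    x l       = refl
length-insertAt (suc i) x []      = refl
length-insertAt (suc i) x (y ∷ l) = cong suc (length-insertAt i x l)

cycAux-shape : ∀ g j → Σ (List ℕ) λ t → cycAux g j ≡ 1 ∷ t × length t ≡ 2 + j
cycAux-shape g zero    = 2 ∷ 3 ∷ [] , refl , refl
cycAux-shape g (suc j) with cycAux-shape g j
... | t , eq , len rewrite eq =
  insertAt (g j) (4 + j) t , refl , trans (length-insertAt (g j) (4 + j) t) (cong suc len)

-- The edges of the cycle on j + 3 nodes; node j + 4 will be inserted into subdivided g j.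
cycEdges : (ℕ → ℕ) → ℕ → List Edge
cycEdges g j = cycleEdges (cycAux g j)

subdivided : (ℕ → ℕ) → ℕ → Edge
subdivided g j = edgeAt (cycEdges g j) (g j)

nu≡subdivided : ∀ g j → g j < 3 + j → nu g (4 + j) ≡ subdivided g j
nu≡subdivided g j gj< with cycAux-shape g j
... | t , eq , len rewrite eq = sym (edgeAt-pathEdges 1 1 t (g j) (subst (g j ≤_) (sym len) (≤-pred gj<)))

length-cycEdges : ∀ g j → length (cycEdges g j) ≡ 3 + j
length-cycEdges g j with cycAux-shape g j
... | t , eq , len rewrite eq = trans (length-pathEdges 1 1 t) (cong suc len)

cycEdges-suc : ∀ g j → g j < 3 + j → Σ ℕ λ u → Σ ℕ λ v →
  subdivided g j ≡ edge u v ×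
  cycEdges g (suc j) ≡
    take (g j) (cycEdges g j) ++ edge u (4 + j) ∷ edge (4 + j) v ∷ drop (suc (g j)) (cycEdges g j)
cycEdges-suc g j gj< with cycAux-shape g j
... | t , eq , len rewrite eq = pathEdges-insertAt 1 1 t (g j) (4 + j) (subst (g j ≤_) (sym len) (≤-pred gj<))

∑-splice : ∀ (w : Edge → ℕ) L i u v → i < length L →
  ∑ w (take i L ++ u ∷ v ∷ drop (suc i) L) + w (edgeAt L i) ≡ ∑ w L + w u + w v
∑-splice w (e ∷ L) zero    u v _ = rearrange (w u) (w v) (∑ w L) (w e)
  where
  rearrange : ∀ a b c d → a + (b + c) + d ≡ d + c + a + b
  rearrange = solve-∀
∑-splice w (e ∷ L) (suc i) u v (s≤s i<L) = begin
  w e + ∑ w S + w (edgeAt L i)   ≡⟨ +-assoc (w e) _ _ ⟩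
  w e + (∑ w S + w (edgeAt L i)) ≡⟨ cong (w e +_) (∑-splice w L i u v i<L) ⟩
  w e + (∑ w L + w u + w v)      ≡⟨ reassoc (w e) (∑ w L) (w u) (w v) ⟩
  w e + ∑ w L + w u + w v        ∎
  where
  open ≡-Reasoning
  S = take i L ++ u ∷ v ∷ drop (suc i) L
  reassoc : ∀ a b c d → a + (b + c + d) ≡ a + b + c + d
  reassoc = solve-∀

ValidEdge : ℕ → Edge → Set
ValidEdge m e = 1 ≤ proj₁ e × proj₁ e < proj₂ e × proj₂ e ≤ m

ValidEdge-weaken : ∀ {m e} → ValidEdge m e → ValidEdge (suc m) e
ValidEdge-weaken (1≤a , a<b , b≤m) = 1≤a , a<b , ≤-trans b≤m (n≤1+n _)

ValidEdge-edge : ∀ m u v → ValidEdge m (edge u v) → 1 ≤ u × u ≤ m × 1 ≤ v × v ≤ m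
ValidEdge-edge m u v (1≤u⊓v , u⊓v<u⊔v , u⊔v≤m) =
  ≤-trans 1≤u⊓v (m⊓n≤m u v) , ≤-trans (m≤m⊔n u v) u⊔v≤m ,
  ≤-trans 1≤u⊓v (m⊓n≤n u v) , ≤-trans (m≤n⊔m u v) u⊔v≤m

edge-< : ∀ u x → u < x → edge u x ≡ (u , x)
edge-< u x u<x = cong₂ _,_ (m≤n⇒m⊓n≡m (<⇒≤ u<x)) (m≤n⇒m⊔n≡n (<⇒≤ u<x))

edge-> : ∀ x v → v < x → edge x v ≡ (v , x)
edge-> x v v<x = cong₂ _,_ (m≥n⇒m⊓n≡n (<⇒≤ v<x)) (m≥n⇒m⊔n≡m (<⇒≤ v<x))

sum-over-sorted : ∀ (w : Edge → ℕ) u v x → w (u , x) + w (v , x) ≡ w (u ⊓ v , x) + w (u ⊔ v , x)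
sum-over-sorted w u v x with ≤-total u v
... | inj₁ u≤v rewrite m≤n⇒m⊓n≡m u≤v | m≤n⇒m⊔n≡n u≤v = refl
... | inj₂ v≤u rewrite m≥n⇒m⊓n≡n v≤u | m≥n⇒m⊔n≡m v≤u = +-comm (w (u , x)) (w (v , x))

index<length-cycEdges : ∀ g j → g j < 3 + j → g j < length (cycEdges g j)
index<length-cycEdges g j gj< = subst (g j <_) (sym (length-cycEdges g j)) gj<

edgeAt-All : ∀ {P : Edge → Set} L i → All P L → i < length L → P (edgeAt L i)
edgeAt-All (e ∷ L) zero    (pe ∷ _)  _         = pe
edgeAt-All (e ∷ L) (suc i) (_ ∷ pL)  (s≤s i<L) = edgeAt-All L i pL i<L

subdivided-valid : ∀ g j → g j < 3 + j → All (ValidEdge (3 + j)) (cycEdges g j) →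
  ValidEdge (3 + j) (subdivided g j)
subdivided-valid g j gj< valid = edgeAt-All (cycEdges g j) (g j) valid (index<length-cycEdges g j gj<)

∑-cycEdges-suc : ∀ g j → g j < 3 + j → All (ValidEdge (3 + j)) (cycEdges g j) → ∀ w →
  let (a , b) = subdivided g j in
  ∑ w (cycEdges g (suc j)) + w (a , b) ≡ ∑ w (cycEdges g j) + w (a , 4 + j) + w (b , 4 + j)
∑-cycEdges-suc g j gj< valid w with cycEdges-suc g j gj<
... | u , v , sub≡ , cyc≡ rewrite cyc≡ = begin
  ∑ w (take (g j) L ++ edge u x ∷ edge x v ∷ drop (suc (g j)) L) + w (edgeAt L (g j))
    ≡⟨ ∑-splice w L (g j) (edge u x) (edge x v) (index<length-cycEdges g j gj<) ⟩
  ∑ w L + w (edge u x) + w (edge x v)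
    ≡⟨ +-assoc (∑ w L) _ _ ⟩
  ∑ w L + (w (edge u x) + w (edge x v))
    ≡⟨ cong (∑ w L +_) ends ⟩
  ∑ w L + (w (a , x) + w (b , x))
    ≡⟨ +-assoc (∑ w L) _ _ ⟨
  ∑ w L + w (a , x) + w (b , x) ∎
  where
  open ≡-Reasoning
  L = cycEdges g j
  x = 4 + j
  a = proj₁ (subdivided g j)
  b = proj₂ (subdivided g j)
  uv = ValidEdge-edge (3 + j) u v (subst (ValidEdge (3 + j)) sub≡ (subdivided-valid g j gj< valid))
  ends : w (edge u x) + w (edge x v) ≡ w (a , x) + w (b , x)
  ends = begin
    w (edge u x) + w (edge x v)     ≡⟨ cong₂ _+_ (cong w (edge-< u x (s≤s (proj₁ (proj₂ uv)))))
                                                  (cong w (edge-> x v (s≤s (proj₂ (proj₂ (proj₂ uv)))))) ⟩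
    w (u , x) + w (v , x)           ≡⟨ sum-over-sorted w u v x ⟩
    w (u ⊓ v , x) + w (u ⊔ v , x)   ≡⟨ cong₂ (λ s t → w (s , x) + w (t , x)) (cong proj₁ sub≡) (cong proj₂ sub≡) ⟨
    w (a , x) + w (b , x)           ∎

-- Cycle invariants

mult : Edge → List Edge → ℕ
mult e L = ∑ (λ f → 𝟙 (eqPair e f)) L

incidence : ℕ → Edge → ℕ
incidence c f = 𝟙 (c ≡ᵇ proj₁ f) + 𝟙 (c ≡ᵇ proj₂ f)

degree : ℕ → List Edge → ℕ
degree c L = ∑ (incidence c) L

Admissible : (ℕ → ℕ) → ℕ → Set
Admissible g j = ∀ k → k < j → g k < 3 + k

Admissible-mono : ∀ g {i j} → i ≤ j → Admissible g j → Admissible g i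
Admissible-mono g i≤j adm k k<i = adm k (≤-trans k<i i≤j)

Admissible-pred : ∀ g j → Admissible g (suc j) → Admissible g j
Admissible-pred g j = Admissible-mono g (n≤1+n j)

record CycleInvariant (g : ℕ → ℕ) (j : ℕ) : Set where
  field
    valid   : All (ValidEdge (3 + j)) (cycEdges g j)
    simple  : ∀ e → mult e (cycEdges g j) ≤ 1
    regular : ∀ c → 1 ≤ c → c ≤ 3 + j → degree c (cycEdges g j) ≡ 2
open CycleInvariant public

𝟙-eqPair-distinct : ∀ e u v → u ≢ v → 𝟙 (eqPair e u) + 𝟙 (eqPair e v) ≤ 1
𝟙-eqPair-distinct e u v u≢v with eqPair e u in h
... | false = 𝟙≤1 (eqPair e v)
... | true rewrite ≢⇒eqPair-false e v (λ e≡v → u≢v (trans (sym (eqPair-true⇒≡ e u h)) e≡v)) = ≤-refl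

mult-beyond : ∀ m e L → All (ValidEdge m) L → m < proj₂ e → mult e L ≡ 0
mult-beyond m e L valid m<e = trans (∑-congᴬ valid absent) (∑-const 0 L)
  where
  absent : ∀ f → ValidEdge m f → 𝟙 (eqPair e f) ≡ 0
  absent f (_ , _ , f≤m) = cong 𝟙 (≢⇒eqPair-false e f (λ e≡f → <⇒≱ m<e (subst (λ t → proj₂ t ≤ m) (sym e≡f) f≤m)))

degree-beyond : ∀ m c L → All (ValidEdge m) L → m < c → degree c L ≡ 0
degree-beyond m c L valid m<c = trans (∑-congᴬ valid absent) (∑-const 0 L)
  where
  absent : ∀ f → ValidEdge m f → incidence c f ≡ 0
  absent f (_ , a<b , b≤m) =
    cong₂ _+_ (cong 𝟙 (≢⇒≡ᵇ-false c _ (λ c≡a → <⇒≱ m<c (subst (_≤ m) (sym c≡a) (≤-trans (<⇒≤ a<b) b≤m)))))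
              (cong 𝟙 (≢⇒≡ᵇ-false c _ (λ c≡b → <⇒≱ m<c (subst (_≤ m) (sym c≡b) b≤m))))

triangle-edge : ∀ e → ValidEdge 3 e → e ≡ (1 , 2) ⊎ e ≡ (1 , 3) ⊎ e ≡ (2 , 3)
triangle-edge (1 , 2) _ = inj₁ refl
triangle-edge (1 , 3) _ = inj₂ (inj₁ refl)
triangle-edge (2 , 3) _ = inj₂ (inj₂ refl)
triangle-edge (0 , _) (() , _)
triangle-edge (1 , 0) (_ , () , _)
triangle-edge (1 , 1) (_ , s≤s () , _)
triangle-edge (1 , suc (suc (suc (suc _)))) (_ , _ , s≤s (s≤s (s≤s ())))
triangle-edge (2 , 0) (_ , () , _)
triangle-edge (2 , 1) (_ , s≤s () , _)
triangle-edge (2 , 2) (_ , s≤s (s≤s ()) , _)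
triangle-edge (2 , suc (suc (suc (suc _)))) (_ , _ , s≤s (s≤s (s≤s ())))
triangle-edge (suc (suc (suc a)) , b) (_ , a<b , b≤3) with s≤s (s≤s (s≤s ())) ← ≤-trans a<b b≤3

mult-triangle : ∀ g e → ValidEdge 3 e → mult e (cycEdges g 0) ≡ 1
mult-triangle g e e-valid with triangle-edge e e-valid
... | inj₁ refl        = refl
... | inj₂ (inj₁ refl) = refl
... | inj₂ (inj₂ refl) = refl

invariant-base : ∀ g → CycleInvariant g 0
invariant-base g = record { valid = valid₀ ; simple = simple₀ ; regular = regular₀ }
  where
  valid₀ : All (ValidEdge 3) (cycEdges g 0)
  valid₀ = (≤-refl , ≤-refl , s≤s (s≤s z≤n)) ∷ (s≤s z≤n , ≤-refl , ≤-refl) ∷ (≤-refl , s≤s (s≤s z≤n) , ≤-refl) ∷ []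
  simple₀ : ∀ e → mult e (cycEdges g 0) ≤ 1
  simple₀ e with eqPair e (1 , 2) in h
  ... | true rewrite eqPair-true⇒≡ e (1 , 2) h = ≤-refl
  ... | false = subst (λ t → 𝟙 (eqPair e (2 , 3)) + t ≤ 1) (sym (+-identityʳ _))
                      (𝟙-eqPair-distinct e (2 , 3) (1 , 3) (λ ()))
  regular₀ : ∀ c → 1 ≤ c → c ≤ 3 → degree c (cycEdges g 0) ≡ 2
  regular₀ 1 _ _ = refl
  regular₀ 2 _ _ = refl
  regular₀ 3 _ _ = refl
  regular₀ (suc (suc (suc (suc _)))) _ (s≤s (s≤s (s≤s ())))

module InvariantStep (g : ℕ → ℕ) (j : ℕ) (gj< : g j < 3 + j) (I : CycleInvariant g j) where
  private
    L  = cycEdges g j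
    L′ = cycEdges g (suc j)
    x  = 4 + j
    a  = proj₁ (subdivided g j)
    b  = proj₂ (subdivided g j)
    ab-valid : ValidEdge (3 + j) (a , b)
    ab-valid = subdivided-valid g j gj< (valid I)
    a<x : a < x
    a<x = s≤s (≤-trans (<⇒≤ (proj₁ (proj₂ ab-valid))) (proj₂ (proj₂ ab-valid)))
    b<x : b < x
    b<x = s≤s (proj₂ (proj₂ ab-valid))

  valid-suc : All (ValidEdge x) L′
  valid-suc with cycEdges-suc g j gj<
  ... | u , v , sub≡ , cyc≡ rewrite cyc≡ =
    ++⁺ (take⁺ (g j) old) (ux-valid ∷ xv-valid ∷ drop⁺ (suc (g j)) old)
    where
    old = All.map ValidEdge-weaken (valid I)
    uv = ValidEdge-edge (3 + j) u v (subst (ValidEdge (3 + j)) sub≡ ab-valid)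
    ux-valid : ValidEdge x (edge u x)
    ux-valid = subst (ValidEdge x) (sym (edge-< u x (s≤s (proj₁ (proj₂ uv)))))
                     (proj₁ uv , s≤s (proj₁ (proj₂ uv)) , ≤-refl)
    xv-valid : ValidEdge x (edge x v)
    xv-valid = subst (ValidEdge x) (sym (edge-> x v (s≤s (proj₂ (proj₂ (proj₂ uv))))))
                     (proj₁ (proj₂ (proj₂ uv)) , s≤s (proj₂ (proj₂ (proj₂ uv))) , ≤-refl)

  simple-suc : ∀ e → mult e L′ ≤ 1
  simple-suc e with proj₂ e ≟ x
  ... | yes e₂≡x = begin
    mult e L′                                            ≤⟨ m≤m+n _ _ ⟩
    mult e L′ + 𝟙 (eqPair e (a , b))                     ≡⟨ step ⟩
    mult e L + 𝟙 (eqPair e (a , x)) + 𝟙 (eqPair e (b , x))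
      ≡⟨ cong (λ t → t + 𝟙 (eqPair e (a , x)) + 𝟙 (eqPair e (b , x))) old-absent ⟩
    𝟙 (eqPair e (a , x)) + 𝟙 (eqPair e (b , x))
      ≤⟨ 𝟙-eqPair-distinct e _ _ (λ ax≡bx → <⇒≢ (proj₁ (proj₂ ab-valid)) (cong proj₁ ax≡bx)) ⟩
    1                                                    ∎
    where
    open ≤-Reasoning
    step = ∑-cycEdges-suc g j gj< (valid I) (λ f → 𝟙 (eqPair e f))
    old-absent : mult e L ≡ 0
    old-absent = mult-beyond (3 + j) e L (valid I) (subst (3 + j <_) (sym e₂≡x) ≤-refl)
  ... | no e₂≢x = begin
    mult e L′                                            ≤⟨ m≤m+n _ _ ⟩
    mult e L′ + 𝟙 (eqPair e (a , b))                     ≡⟨ step ⟩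
    mult e L + 𝟙 (eqPair e (a , x)) + 𝟙 (eqPair e (b , x)) ≡⟨ cong₂ (λ s t → mult e L + s + t) (new-absent a) (new-absent b) ⟩
    mult e L + 0 + 0                                     ≡⟨ cong (_+ 0) (+-identityʳ _) ⟩
    mult e L + 0                                         ≡⟨ +-identityʳ _ ⟩
    mult e L                                             ≤⟨ simple I e ⟩
    1                                                    ∎
    where
    open ≤-Reasoning
    step = ∑-cycEdges-suc g j gj< (valid I) (λ f → 𝟙 (eqPair e f))
    new-absent : ∀ c → 𝟙 (eqPair e (c , x)) ≡ 0
    new-absent c = cong 𝟙 (≢⇒eqPair-false e (c , x) (λ e≡cx → e₂≢x (cong proj₂ e≡cx)))

  regular-suc : ∀ c → 1 ≤ c → c ≤ 3 + suc j → degree c L′ ≡ 2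
  regular-suc c 1≤c c≤x with m≤n⇒m<n∨m≡n c≤x
  ... | inj₁ (s≤s c≤3+j) = +-cancelʳ-≡ (incidence c (a , b)) (degree c L′) 2 (begin
    degree c L′ + incidence c (a , b)                           ≡⟨ step ⟩
    degree c L + incidence c (a , x) + incidence c (b , x)
      ≡⟨ cong (λ t → t + incidence c (a , x) + incidence c (b , x)) (regular I c 1≤c c≤3+j) ⟩
    2 + incidence c (a , x) + incidence c (b , x)               ≡⟨ +-assoc 2 (incidence c (a , x)) (incidence c (b , x)) ⟩
    2 + (incidence c (a , x) + incidence c (b , x))             ≡⟨ cong (2 +_) split ⟩
    2 + incidence c (a , b)                                     ∎)
    where
    open ≡-Reasoning
    step = ∑-cycEdges-suc g j gj< (valid I) (incidence c)
    c≢x : (c ≡ᵇ x) ≡ false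
    c≢x = ≢⇒≡ᵇ-false c x (<⇒≢ (s≤s c≤3+j))
    split : incidence c (a , x) + incidence c (b , x) ≡ incidence c (a , b)
    split rewrite c≢x = cong₂ _+_ (+-identityʳ (𝟙 (c ≡ᵇ a))) (+-identityʳ (𝟙 (c ≡ᵇ b)))
  ... | inj₂ refl = +-cancelʳ-≡ (incidence c (a , b)) (degree c L′) 2 (begin
    degree c L′ + incidence c (a , b)                        ≡⟨ step ⟩
    degree c L + incidence c (a , c) + incidence c (b , c)
      ≡⟨ cong (λ t → t + incidence c (a , c) + incidence c (b , c)) (degree-beyond (3 + j) c L (valid I) ≤-refl) ⟩
    incidence c (a , c) + incidence c (b , c)                ≡⟨ new ⟩
    2 + incidence c (a , b)                                  ∎)
    where
    open ≡-Reasoning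
    step = ∑-cycEdges-suc g j gj< (valid I) (incidence c)
    new : incidence c (a , c) + incidence c (b , c) ≡ 2 + incidence c (a , b)
    new rewrite ≢⇒≡ᵇ-false c a (>⇒≢ a<x) | ≢⇒≡ᵇ-false c b (>⇒≢ b<x) | ≡ᵇ-refl c = refl

invariant : ∀ g j → Admissible g j → CycleInvariant g j
invariant g zero    _   = invariant-base g
invariant g (suc j) adm = record { valid = valid-suc ; simple = simple-suc ; regular = regular-suc }
  where open InvariantStep g j (adm j ≤-refl) (invariant g j (Admissible-pred g j adm))

-- How an edge enters and leaves the cycle

mult-old-suc : ∀ g k e → Admissible g (suc k) → proj₂ e ≤ 3 + k →
  mult e (cycEdges g (suc k)) + 𝟙 (eqPair e (subdivided g k)) ≡ mult e (cycEdges g k)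
mult-old-suc g k e adm e≤ = begin
  mult e (cycEdges g (suc k)) + 𝟙 (eqPair e (subdivided g k))
    ≡⟨ ∑-cycEdges-suc g k (adm k ≤-refl) (valid (invariant g k (Admissible-pred g k adm))) (λ f → 𝟙 (eqPair e f)) ⟩
  mult e L + 𝟙 (eqPair e (a , 4 + k)) + 𝟙 (eqPair e (b , 4 + k))
    ≡⟨ cong₂ (λ s t → mult e L + s + t) (new-absent a) (new-absent b) ⟩
  mult e L + 0 + 0
    ≡⟨ trans (+-identityʳ _) (+-identityʳ _) ⟩
  mult e L ∎
  where
  open ≡-Reasoning
  L = cycEdges g k
  a = proj₁ (subdivided g k)
  b = proj₂ (subdivided g k)
  new-absent : ∀ c → 𝟙 (eqPair e (c , 4 + k)) ≡ 0
  new-absent c = cong 𝟙 (≢⇒eqPair-false e (c , 4 + k) (λ e≡cx → <⇒≱ (s≤s e≤) (≤-reflexive (sym (cong proj₂ e≡cx)))))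

mult-new-suc : ∀ g k c → Admissible g (suc k) →
  mult (c , 4 + k) (cycEdges g (suc k)) ≡ incidence c (subdivided g k)
mult-new-suc g k c adm = +-cancelʳ-≡ (𝟙 (eqPair e (a , b))) _ _ (begin
  mult e (cycEdges g (suc k)) + 𝟙 (eqPair e (a , b))
    ≡⟨ ∑-cycEdges-suc g k (adm k ≤-refl) (valid I) (λ f → 𝟙 (eqPair e f)) ⟩
  mult e L + 𝟙 (eqPair e (a , 4 + k)) + 𝟙 (eqPair e (b , 4 + k))
    ≡⟨ cong (λ t → t + 𝟙 (eqPair e (a , 4 + k)) + 𝟙 (eqPair e (b , 4 + k))) (mult-beyond (3 + k) e L (valid I) ≤-refl) ⟩
  𝟙 (eqPair e (a , 4 + k)) + 𝟙 (eqPair e (b , 4 + k))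
    ≡⟨ cong₂ _+_ (same-end a) (same-end b) ⟩
  incidence c (a , b)
    ≡⟨ +-identityʳ _ ⟨
  incidence c (a , b) + 0
    ≡⟨ cong (incidence c (a , b) +_) ab-absent ⟨
  incidence c (a , b) + 𝟙 (eqPair e (a , b)) ∎)
  where
  open ≡-Reasoning
  I = invariant g k (Admissible-pred g k adm)
  L = cycEdges g k
  e = (c , 4 + k)
  a = proj₁ (subdivided g k)
  b = proj₂ (subdivided g k)
  ab-valid = subdivided-valid g k (adm k ≤-refl) (valid I)
  same-end : ∀ d → 𝟙 (eqPair e (d , 4 + k)) ≡ 𝟙 (c ≡ᵇ d)
  same-end d rewrite ≡ᵇ-refl k = cong 𝟙 (∧-identityʳ (c ≡ᵇ d))
  ab-absent : 𝟙 (eqPair e (a , b)) ≡ 0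
  ab-absent = cong 𝟙 (≢⇒eqPair-false e (a , b)
                (λ e≡ab → <⇒≱ (≤-refl {4 + k}) (subst (_≤ 3 + k) (sym (cong proj₂ e≡ab)) (proj₂ (proj₂ ab-valid)))))

mult-antitone : ∀ g e {j₀ j} → j₀ ≤ j → Admissible g j → proj₂ e ≤ 3 + j₀ →
  mult e (cycEdges g j) ≤ mult e (cycEdges g j₀)
mult-antitone g e {j₀} {zero}  z≤n  adm e≤ = ≤-refl
mult-antitone g e {j₀} {suc j} j₀≤ adm e≤ with m≤n⇒m<n∨m≡n j₀≤
... | inj₂ refl        = ≤-refl
... | inj₁ (s≤s j₀≤j) = begin
  mult e (cycEdges g (suc j))                                  ≤⟨ m≤m+n _ _ ⟩
  mult e (cycEdges g (suc j)) + 𝟙 (eqPair e (subdivided g j))  ≡⟨ mult-old-suc g j e adm (≤-trans e≤ (+-monoʳ-≤ 3 j₀≤j)) ⟩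
  mult e (cycEdges g j)                                        ≤⟨ mult-antitone g e j₀≤j (Admissible-pred g j adm) e≤ ⟩
  mult e (cycEdges g j₀)                                       ∎
  where open ≤-Reasoning

mult-preserved : ∀ g e {j₀ j} → j₀ ≤ j → Admissible g j → proj₂ e ≤ 3 + j₀ →
  (∀ t → t < j → eqPair e (subdivided g t) ≡ false) → mult e (cycEdges g j) ≡ mult e (cycEdges g j₀)
mult-preserved g e {j₀} {zero}  z≤n  adm e≤ untouched = refl
mult-preserved g e {j₀} {suc j} j₀≤ adm e≤ untouched with m≤n⇒m<n∨m≡n j₀≤
... | inj₂ refl        = refl
... | inj₁ (s≤s j₀≤j) = begin
  mult e (cycEdges g (suc j))                                  ≡⟨ +-identityʳ _ ⟨
  mult e (cycEdges g (suc j)) + 0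
    ≡⟨ cong (λ t → mult e (cycEdges g (suc j)) + 𝟙 t) (untouched j ≤-refl) ⟨
  mult e (cycEdges g (suc j)) + 𝟙 (eqPair e (subdivided g j))  ≡⟨ mult-old-suc g j e adm (≤-trans e≤ (+-monoʳ-≤ 3 j₀≤j)) ⟩
  mult e (cycEdges g j)
    ≡⟨ mult-preserved g e j₀≤j (Admissible-pred g j adm) e≤ (λ t t<j → untouched t (≤-trans t<j (n≤1+n j))) ⟩
  mult e (cycEdges g j₀)                                       ∎
  where open ≡-Reasoning

mult-edgeAt : ∀ L i → i < length L → 1 ≤ mult (edgeAt L i) L
mult-edgeAt (e ∷ L) zero    _         rewrite eqPair-refl e = s≤s z≤n
mult-edgeAt (e ∷ L) (suc i) (s≤s i<L) = ≤-trans (mult-edgeAt L i i<L) (m≤n+m _ _)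

mult-All : ∀ {P : Edge → Set} e L → All P L → 1 ≤ mult e L → P e
mult-All {P} e (f ∷ L) (pf ∷ pL) e∈ with eqPair e f in e≟f
... | true  = subst P (sym (eqPair-true⇒≡ e f e≟f)) pf
... | false = mult-All e L pL e∈

Admissible⇒subdivided-valid : ∀ g k → Admissible g (suc k) → ValidEdge (3 + k) (subdivided g k)
Admissible⇒subdivided-valid g k adm = subdivided-valid g k (adm k ≤-refl) (valid (invariant g k (Admissible-pred g k adm)))

∈-cycEdges⇒not-subdivided : ∀ g e {j k} → Admissible g j → 1 ≤ mult e (cycEdges g j) → k < j →
  eqPair e (subdivided g k) ≡ false
∈-cycEdges⇒not-subdivided g e {j} {k} adm e∈ k<j with eqPair e (subdivided g k) in e≟sub
... | false = refl
... | true  = contradiction (≤-trans two (simple (invariant g k (Admissible-pred g k admₖ)) e)) λ { (s≤s ()) }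
  where
  admₖ = Admissible-mono g k<j adm
  e≤ : proj₂ e ≤ 3 + k
  e≤ = subst (λ t → proj₂ t ≤ 3 + k) (sym (eqPair-true⇒≡ e (subdivided g k) e≟sub))
             (proj₂ (proj₂ (Admissible⇒subdivided-valid g k admₖ)))
  two : 2 ≤ mult e (cycEdges g k)
  two = begin
    2
      ≤⟨ +-monoˡ-≤ 1 (≤-trans e∈ (mult-antitone g e k<j adm (≤-trans e≤ (n≤1+n _)))) ⟩
    mult e (cycEdges g (suc k)) + 1                              ≡⟨ cong (λ t → mult e (cycEdges g (suc k)) + 𝟙 t) e≟sub ⟨
    mult e (cycEdges g (suc k)) + 𝟙 (eqPair e (subdivided g k))  ≡⟨ mult-old-suc g k e admₖ e≤ ⟩
    mult e (cycEdges g k)                                        ∎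
    where open ≤-Reasoning

∈-cycEdges⇒born : ∀ g e {j k} → Admissible g j → 1 ≤ mult e (cycEdges g j) → proj₂ e ≡ 4 + k → k < j →
  1 ≤ incidence (proj₁ e) (subdivided g k)
∈-cycEdges⇒born g e {j} {k} adm e∈ e₂≡ k<j = begin
  1                                            ≤⟨ e∈ ⟩
  mult e (cycEdges g j)                        ≤⟨ mult-antitone g e k<j adm (≤-reflexive e₂≡) ⟩
  mult e (cycEdges g (suc k))                  ≡⟨ cong (λ t → mult (proj₁ e , t) (cycEdges g (suc k))) e₂≡ ⟩
  mult (proj₁ e , 4 + k) (cycEdges g (suc k))  ≡⟨ mult-new-suc g k (proj₁ e) (Admissible-mono g k<j adm) ⟩
  incidence (proj₁ e) (subdivided g k)         ∎
  where open ≤-Reasoning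

incident⇒¬disjoint : ∀ c₁ c₂ a₁ a₂ → 1 ≤ incidence a₁ (c₁ , c₂) → disjointPair (c₁ , c₂) (a₁ , a₂) ≡ false
incident⇒¬disjoint c₁ c₂ a₁ a₂ a₁∈ rewrite ≡ᵇ-sym a₁ c₁ | ≡ᵇ-sym a₁ c₂ with c₁ ≡ᵇ a₁ | c₂ ≡ᵇ a₁ | a₁∈
... | true  | _     | _ = refl
... | false | true  | _ = cong not (∨-zeroʳ (c₁ ≡ᵇ a₂))
... | false | false | ()

¬disjoint⇒incident : ∀ c₁ c₂ a₁ a₂ → (c₁ ≡ᵇ a₂) ≡ false → (c₂ ≡ᵇ a₂) ≡ false →
  disjointPair (c₁ , c₂) (a₁ , a₂) ≡ false → 1 ≤ incidence a₁ (c₁ , c₂)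
¬disjoint⇒incident c₁ c₂ a₁ a₂ c₁≢a₂ c₂≢a₂ meets
  rewrite ≡ᵇ-sym a₁ c₁ | ≡ᵇ-sym a₁ c₂ | c₁≢a₂ | c₂≢a₂ with c₁ ≡ᵇ a₁ | c₂ ≡ᵇ a₁ | meets
... | true  | _     | _  = s≤s z≤n
... | false | true  | _  = s≤s z≤n
... | false | false | ()

-- For a = ν_A(n) and b = ν_B(k + 4), conditions (i) and (iii) of the pedigree edge {k + 4 , n} fail.
Unattached : Edge → Edge → ℕ → Set
Unattached a b k = eqPair a b ≡ false × ((4 + k ≡ᵇ proj₂ a) ∧ disjointPair b a) ≡ false

∈-cycEdges⇒unattached : ∀ g a {j} → Admissible g j → 1 ≤ mult a (cycEdges g j) →
  ∀ k → k < j → Unattached a (subdivided g k) k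
∈-cycEdges⇒unattached g a adm a∈ k k<j = ∈-cycEdges⇒not-subdivided g a adm a∈ k<j , not-born-at-k
  where
  not-born-at-k : ((4 + k ≡ᵇ proj₂ a) ∧ disjointPair (subdivided g k) a) ≡ false
  not-born-at-k with 4 + k ≡ᵇ proj₂ a in born
  ... | false = refl
  ... | true  = incident⇒¬disjoint (proj₁ (subdivided g k)) (proj₂ (subdivided g k)) (proj₁ a) (proj₂ a)
                  (∈-cycEdges⇒born g a adm a∈ (sym (≡ᵇ-true⇒≡ _ _ born)) k<j)

-- a = (c , k + 4) is created in B too: either ν_A(k + 4) = ν_B(k + 4), or, condition (iii) failing,
-- c is an endpoint of ν_B(k + 4).
born-alike : ∀ f g a {j k} → Admissible f j → Admissible g j → 1 ≤ mult a (cycEdges f j) →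
  proj₂ a ≡ 4 + k → k < j →
  (eqPair (subdivided f k) (subdivided g k) ≡ false → Unattached a (subdivided g k) k) →
  1 ≤ mult a (cycEdges g (suc k))
born-alike f g a {j} {k} admf admg a∈ a₂≡ k<j unattached = begin
  1                                            ≤⟨ incident-in-g ⟩
  incidence (proj₁ a) (subdivided g k)         ≡⟨ mult-new-suc g k (proj₁ a) (Admissible-mono g k<j admg) ⟨
  mult (proj₁ a , 4 + k) (cycEdges g (suc k))  ≡⟨ cong (λ t → mult (proj₁ a , t) (cycEdges g (suc k))) a₂≡ ⟨
  mult a (cycEdges g (suc k))                  ∎
  where
  open ≤-Reasoning
  b = subdivided g k
  b-valid = Admissible⇒subdivided-valid g k (Admissible-mono g k<j admg)
  incident-in-f : 1 ≤ incidence (proj₁ a) (subdivided f k)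
  incident-in-f = ∈-cycEdges⇒born f a admf a∈ a₂≡ k<j
  below-a₂ : ∀ c → c ≤ 3 + k → (c ≡ᵇ proj₂ a) ≡ false
  below-a₂ c c≤ = ≢⇒≡ᵇ-false c (proj₂ a) (λ c≡ → <⇒≱ (≤-reflexive (sym a₂≡)) (subst (_≤ 3 + k) c≡ c≤))
  born-at-k : (4 + k ≡ᵇ proj₂ a) ≡ true
  born-at-k = subst (λ t → (4 + k ≡ᵇ t) ≡ true) (sym a₂≡) (≡ᵇ-refl (4 + k))
  incident-in-g : 1 ≤ incidence (proj₁ a) b
  incident-in-g with eqPair (subdivided f k) b Bool.≟ false
  ... | no same   = subst (λ e → 1 ≤ incidence (proj₁ a) e) (eqPair-true⇒≡ _ _ (¬-not same)) incident-in-f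
  ... | yes differ = ¬disjoint⇒incident (proj₁ b) (proj₂ b) (proj₁ a) (proj₂ a)
                       (below-a₂ (proj₁ b) (≤-trans (<⇒≤ (proj₁ (proj₂ b-valid))) (proj₂ (proj₂ b-valid))))
                       (below-a₂ (proj₂ b) (proj₂ (proj₂ b-valid)))
                       (subst (λ t → (t ∧ disjointPair b a) ≡ false) born-at-k (proj₂ (unattached differ)))

unattached⇒∈-cycEdges : ∀ f g a {j} → Admissible f j → Admissible g j → 1 ≤ mult a (cycEdges f j) →
  (∀ k → k < j → eqPair (subdivided f k) (subdivided g k) ≡ false → Unattached a (subdivided g k) k) →
  1 ≤ mult a (cycEdges g j)
unattached⇒∈-cycEdges f g a {j} admf admg a∈ unattached = born (proj₂ a ≤? 3)
  where
  a-valid = mult-All a (cycEdges f j) (valid (invariant f j admf)) a∈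
  untouched : ∀ t → t < j → eqPair a (subdivided g t) ≡ false
  untouched t t<j with eqPair (subdivided f t) (subdivided g t) in same
  ... | false = proj₁ (unattached t t<j same)
  ... | true  = subst (λ b → eqPair a b ≡ false) (eqPair-true⇒≡ _ _ same) (∈-cycEdges⇒not-subdivided f a admf a∈ t<j)
  survives : ∀ j₀ → j₀ ≤ j → proj₂ a ≤ 3 + j₀ → 1 ≤ mult a (cycEdges g j₀) → 1 ≤ mult a (cycEdges g j)
  survives j₀ j₀≤j a≤ a∈₀ = subst (1 ≤_) (sym (mult-preserved g a j₀≤j admg a≤ untouched)) a∈₀
  born : Dec (proj₂ a ≤ 3) → 1 ≤ mult a (cycEdges g j)
  born (yes a≤3) = survives 0 z≤n a≤3 (≤-reflexive (sym (mult-triangle g a (proj₁ a-valid , proj₁ (proj₂ a-valid) , a≤3))))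
  born (no a≰3)  = survives (suc k) k<j (≤-reflexive a₂≡)
                     (born-alike f g a admf admg a∈ a₂≡ k<j (unattached k k<j))
    where
    k = proj₂ a ∸ 4
    a₂≡ : proj₂ a ≡ 4 + k
    a₂≡ = sym (m+[n∸m]≡n (≰⇒> a≰3))
    k<j : k < j
    k<j = +-cancelˡ-≤ 3 _ _ (subst (_≤ 3 + j) a₂≡ (proj₂ (proj₂ a-valid)))

-- Isolated vertices of the pedigree graph

_∈ᵇ_ : Edge → List Edge → Bool
e ∈ᵇ L = 1 ≤ᵇ mult e L

∈ᵇ⁺ : ∀ e L → 1 ≤ mult e L → (e ∈ᵇ L) ≡ true
∈ᵇ⁺ e L e∈ = to T-≡ (≤⇒≤ᵇ e∈)

∈ᵇ⁻ : ∀ e L → (e ∈ᵇ L) ≡ true → 1 ≤ mult e L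
∈ᵇ⁻ e L e∈ = ≤ᵇ⇒≤ 1 (mult e L) (from T-≡ e∈)

crossed : (ℕ → ℕ) → (ℕ → ℕ) → ℕ → Bool
crossed f g j =
  not (eqPair (subdivided f j) (subdivided g j)) ∧ subdivided f j ∈ᵇ cycEdges g j ∧ subdivided g j ∈ᵇ cycEdges f j

allB-upTo⁻ : ∀ (p : ℕ → Bool) n → allB (map p (upTo n)) ≡ true → ∀ k → k < n → p k ≡ true
allB-upTo⁻ p n all-p k k<n = to T-≡ (applyUpTo⁻ (λ i → i) n (all⁺ p (upTo n) (from T-≡ all-p)) k<n)

allB-upTo⁺ : ∀ (p : ℕ → Bool) n → (∀ k → k < n → p k ≡ true) → allB (map p (upTo n)) ≡ true
allB-upTo⁺ p n all-p = to T-≡ (all⁻ p (applyUpTo⁺₁ (λ i → i) n (λ {k} k<n → from T-≡ (all-p k k<n))))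

-- The test isolatedEvent performs on an earlier vertex k + 4, in terms of ν_A(k + 4), ν_B(k + 4), ν_A(n), ν_B(n).
unlinked : ℕ → Edge → Edge → Edge → Edge → Bool
unlinked k aₖ bₖ a b =
  not (not (eqPair aₖ bₖ) ∧ (eqPair a bₖ ∨ eqPair b aₖ ∨
       ((4 + k ≡ᵇ proj₂ a) ∧ disjointPair bₖ a) ∨ ((4 + k ≡ᵇ proj₂ b) ∧ disjointPair aₖ b)))

isolation-test : ∀ f g j k → Admissible f (suc j) → Admissible g (suc j) → k < j →
  not (isVertex f g (4 + k) ∧ isEdge f g (4 + k) (4 + j)) ≡
  unlinked k (subdivided f k) (subdivided g k) (subdivided f j) (subdivided g j)
isolation-test f g j k admf admg k<j =
  cong₂ (λ (aₖ , bₖ) (a , b) → unlinked k aₖ bₖ a b)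
        (cong₂ _,_ (nu≡subdivided f k (admf k k<j′)) (nu≡subdivided g k (admg k k<j′)))
        (cong₂ _,_ (nu≡subdivided f j (admf j ≤-refl)) (nu≡subdivided g j (admg j ≤-refl)))
  where k<j′ = ≤-trans k<j (n≤1+n j)

unlinked⇒unattached : ∀ k aₖ bₖ a b → unlinked k aₖ bₖ a b ≡ true → eqPair aₖ bₖ ≡ false →
  Unattached a bₖ k × Unattached b aₖ k
unlinked⇒unattached k aₖ bₖ a b test aₖ≢bₖ rewrite aₖ≢bₖ
  with eqPair a bₖ | eqPair b aₖ | (4 + k ≡ᵇ proj₂ a) ∧ disjointPair bₖ a | (4 + k ≡ᵇ proj₂ b) ∧ disjointPair aₖ b | test
... | false | false | false | false | _ = (refl , refl) , (refl , refl)
... | true  | _     | _     | _     | ()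
... | false | true  | _     | _     | ()
... | false | false | true  | _     | ()
... | false | false | false | true  | ()

unattached⇒unlinked : ∀ k aₖ bₖ a b → Unattached a bₖ k → Unattached b aₖ k → unlinked k aₖ bₖ a b ≡ true
unattached⇒unlinked k aₖ bₖ a b (a≢bₖ , a-unborn) (b≢aₖ , b-unborn)
  rewrite a≢bₖ | b≢aₖ | a-unborn | b-unborn = cong not (∧-zeroʳ (not (eqPair aₖ bₖ)))

isolated⇒crossed : ∀ f g j → Admissible f (suc j) → Admissible g (suc j) →
  isolatedEvent f g (4 + j) ≡ true → crossed f g j ≡ true
isolated⇒crossed f g j admf admg isolated =
  ∧-intro distinct (∧-intro (∈ᵇ⁺ a (cycEdges g j) a∈) (∈ᵇ⁺ b (cycEdges f j) b∈))
  where
  a = subdivided f j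
  b = subdivided g j
  distinct : not (eqPair a b) ≡ true
  distinct = subst₂ (λ s t → not (eqPair s t) ≡ true)
                    (nu≡subdivided f j (admf j ≤-refl)) (nu≡subdivided g j (admg j ≤-refl))
                    (∧-conicalˡ (isVertex f g (4 + j)) _ isolated)
  test : ∀ k → k < j → unlinked k (subdivided f k) (subdivided g k) a b ≡ true
  test k k<j = trans (sym (isolation-test f g j k admf admg k<j))
                     (allB-upTo⁻ (λ k → not (isVertex f g k ∧ isEdge f g k (4 + j))) (4 + j)
                                 (∧-conicalʳ (isVertex f g (4 + j)) _ isolated) (4 + k) (+-monoʳ-< 4 k<j))
  a∈ : 1 ≤ mult a (cycEdges g j)
  a∈ = unattached⇒∈-cycEdges f g a (Admissible-pred f j admf) (Admissible-pred g j admg)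
         (mult-edgeAt (cycEdges f j) (f j) (index<length-cycEdges f j (admf j ≤-refl)))
         (λ k k<j fₖ≢gₖ → proj₁ (unlinked⇒unattached k _ _ a b (test k k<j) fₖ≢gₖ))
  b∈ : 1 ≤ mult b (cycEdges f j)
  b∈ = unattached⇒∈-cycEdges g f b (Admissible-pred g j admg) (Admissible-pred f j admf)
         (mult-edgeAt (cycEdges g j) (g j) (index<length-cycEdges g j (admg j ≤-refl)))
         (λ k k<j gₖ≢fₖ → proj₂ (unlinked⇒unattached k _ _ a b (test k k<j)
                                   (trans (eqPair-sym (subdivided f k) (subdivided g k)) gₖ≢fₖ)))

crossed⇒isolated : ∀ f g j → Admissible f (suc j) → Admissible g (suc j) →
  crossed f g j ≡ true → isolatedEvent f g (4 + j) ≡ true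
crossed⇒isolated f g j admf admg cross =
  ∧-intro distinct (allB-upTo⁺ (λ k → not (isVertex f g k ∧ isEdge f g k (4 + j))) (4 + j) test)
  where
  a = subdivided f j
  b = subdivided g j
  distinct : not (eqPair (nu f (4 + j)) (nu g (4 + j))) ≡ true
  distinct = subst₂ (λ s t → not (eqPair s t) ≡ true)
                    (sym (nu≡subdivided f j (admf j ≤-refl))) (sym (nu≡subdivided g j (admg j ≤-refl)))
                    (∧-conicalˡ (not (eqPair a b)) _ cross)
  a∈ : 1 ≤ mult a (cycEdges g j)
  a∈ = ∈ᵇ⁻ a (cycEdges g j) (∧-conicalˡ (a ∈ᵇ cycEdges g j) _ (∧-conicalʳ (not (eqPair a b)) _ cross))
  b∈ : 1 ≤ mult b (cycEdges f j)
  b∈ = ∈ᵇ⁻ b (cycEdges f j) (∧-conicalʳ (a ∈ᵇ cycEdges g j) _ (∧-conicalʳ (not (eqPair a b)) _ cross))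
  test : ∀ k → k < 4 + j → not (isVertex f g k ∧ isEdge f g k (4 + j)) ≡ true
  test 0 _ = refl
  test 1 _ = refl
  test 2 _ = refl
  test 3 _ = refl
  test (suc (suc (suc (suc k)))) (s≤s (s≤s (s≤s (s≤s k<j)))) =
    trans (isolation-test f g j k admf admg k<j)
          (unattached⇒unlinked k _ _ a b (∈-cycEdges⇒unattached g a (Admissible-pred g j admg) a∈ k k<j)
                                         (∈-cycEdges⇒unattached f b (Admissible-pred f j admf) b∈ k k<j))

isolated≡crossed : ∀ f g j → Admissible f (suc j) → Admissible g (suc j) →
  isolatedEvent f g (4 + j) ≡ crossed f g j
isolated≡crossed f g j admf admg with isolatedEvent f g (4 + j) in iso | crossed f g j in cross
... | true  | true  = refl
... | false | false = refl
... | true  | false = trans (sym (isolated⇒crossed f g j admf admg iso)) cross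
... | false | true  = trans (sym iso) (crossed⇒isolated f g j admf admg cross)

-- Counting histories

nthD-++ : ∀ p q k → k < length p → nthD (p ++ q) k ≡ nthD p k
nthD-++ (x ∷ p) q zero    _         = refl
nthD-++ (x ∷ p) q (suc k) (s≤s k<p) = nthD-++ p q k k<p

nthD-last : ∀ p i → nthD (p ++ [ i ]) (length p) ≡ i
nthD-last []      i = refl
nthD-last (x ∷ p) i = nthD-last p i

cycAux-cong : ∀ g g′ j → (∀ k → k < j → g k ≡ g′ k) → cycAux g j ≡ cycAux g′ j
cycAux-cong g g′ zero    g≗g′ = refl
cycAux-cong g g′ (suc j) g≗g′ =
  cong₂ (λ i c → insertAt (suc i) (4 + j) c) (g≗g′ j ≤-refl) (cycAux-cong g g′ j (λ k k<j → g≗g′ k (≤-trans k<j (n≤1+n j))))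

ValidPrefix : ℕ → List ℕ → Set
ValidPrefix j p = length p ≡ j × Admissible (nthD p) j

cycEdges-snoc : ∀ j p i → ValidPrefix j p → cycEdges (nthD (p ++ [ i ])) j ≡ cycEdges (nthD p) j
cycEdges-snoc j p i (len , _) =
  cong cycleEdges (cycAux-cong _ _ j (λ k k<j → nthD-++ p [ i ] k (subst (k <_) (sym len) k<j)))

subdivided-snoc : ∀ j p i → ValidPrefix j p → subdivided (nthD (p ++ [ i ])) j ≡ edgeAt (cycEdges (nthD p) j) i
subdivided-snoc j p i ok@(len , _) =
  cong₂ edgeAt (cycEdges-snoc j p i ok) (subst (λ t → nthD (p ++ [ i ]) t ≡ i) len (nthD-last p i))

ValidPrefix-snoc : ∀ j p i → ValidPrefix j p → i < 3 + j → ValidPrefix (suc j) (p ++ [ i ])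
ValidPrefix-snoc j p i (len , adm) i< = trans (length-++ p) (trans (+-comm (length p) 1) (cong suc len)) , adm′
  where
  adm′ : Admissible (nthD (p ++ [ i ])) (suc j)
  adm′ k k<sj with m≤n⇒m<n∨m≡n (≤-pred k<sj)
  ... | inj₁ k<j  rewrite nthD-++ p [ i ] k (subst (k <_) (sym len) k<j) = adm k k<j
  ... | inj₂ refl rewrite sym len | nthD-last p i = i<

prefixes-valid : ∀ j → All (ValidPrefix j) (prefixes j)
prefixes-valid zero    = (refl , λ _ ()) ∷ []
prefixes-valid (suc j) = concat⁺ (map⁺ (All.map children (prefixes-valid j)))
  where
  children : ∀ {p} → ValidPrefix j p → All (ValidPrefix (suc j)) (map (λ i → p ++ [ i ]) (upTo (3 + j)))
  children {p} ok = map⁺ (applyUpTo⁺₁ (λ i → i) (3 + j) (λ {i} i< → ValidPrefix-snoc j p i ok i<))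

∑-map : ∀ {A B : Set} (F : B → ℕ) (h : A → B) xs → ∑ F (map h xs) ≡ ∑ (λ x → F (h x)) xs
∑-map F h xs = cong sum (sym (map-∘ xs))

∑-concatMap : ∀ {A B : Set} (F : B → ℕ) (h : A → List B) xs → ∑ F (concatMap h xs) ≡ ∑ (λ x → ∑ F (h x)) xs
∑-concatMap F h []       = refl
∑-concatMap F h (x ∷ xs) = trans (∑-++ F (h x) (concatMap h xs)) (cong (∑ F (h x) +_) (∑-concatMap F h xs))

∑-prefixes-suc : ∀ j (F : List ℕ → ℕ) →
  ∑ F (prefixes (suc j)) ≡ ∑ (λ p → ∑ (λ i → F (p ++ [ i ])) (upTo (3 + j))) (prefixes j)
∑-prefixes-suc j F = trans (∑-concatMap F _ (prefixes j)) (∑-cong (prefixes j) (λ p → ∑-map F _ (upTo (3 + j))))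

∑-prefixes-cong : ∀ j {F G : List ℕ → ℕ} → (∀ p → ValidPrefix j p → F p ≡ G p) → ∑ F (prefixes j) ≡ ∑ G (prefixes j)
∑-prefixes-cong j = ∑-congᴬ (prefixes-valid j)

∑-indexed : ∀ (w : Edge → ℕ) L → ∑ w L ≡ ∑ (λ i → w (edgeAt L i)) (upTo (length L))
∑-indexed w []      = refl
∑-indexed w (e ∷ L) = cong (w e +_) (trans (∑-indexed w L) (cong sum shift))
  where
  shift : map (λ i → w (edgeAt L i)) (upTo (length L)) ≡ map (λ i → w (edgeAt (e ∷ L) i)) (applyUpTo suc (length L))
  shift = trans (map-applyUpTo (λ i → i) _ (length L)) (sym (map-applyUpTo suc _ (length L)))

∑-cycEdges-indexed : ∀ g j (w : Edge → ℕ) → ∑ (λ i → w (edgeAt (cycEdges g j) i)) (upTo (3 + j)) ≡ ∑ w (cycEdges g j)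
∑-cycEdges-indexed g j w =
  sym (trans (∑-indexed w L) (cong (λ n → ∑ (λ i → w (edgeAt L i)) (upTo n)) (length-cycEdges g j)))
  where L = cycEdges g j

-- The 3 + j choices of the next insertion correspond to the edges of the current cycle.
∑-by-edges : ∀ g j (F : ℕ → ℕ) (A B : Edge → ℕ) →
  (∀ i → i < 3 + j → F i + A (edgeAt (cycEdges g j) i) ≡ B (edgeAt (cycEdges g j) i)) →
  ∑ F (upTo (3 + j)) + ∑ A (cycEdges g j) ≡ ∑ B (cycEdges g j)
∑-by-edges g j F A B pointwise = begin
  ∑ F (upTo (3 + j)) + ∑ A L                                   ≡⟨ cong (∑ F (upTo (3 + j)) +_) (∑-cycEdges-indexed g j A) ⟨
  ∑ F (upTo (3 + j)) + ∑ (λ i → A (edgeAt L i)) (upTo (3 + j))  ≡⟨ ∑-+ F (λ i → A (edgeAt L i)) (upTo (3 + j)) ⟨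
  ∑ (λ i → F i + A (edgeAt L i)) (upTo (3 + j))                ≡⟨ ∑-upTo-cong (3 + j) pointwise ⟩
  ∑ (λ i → B (edgeAt L i)) (upTo (3 + j))                      ≡⟨ ∑-cycEdges-indexed g j B ⟩
  ∑ B L                                                        ∎
  where
  open ≡-Reasoning
  L = cycEdges g j

mult-old-snoc : ∀ j p i e → ValidPrefix j p → i < 3 + j → proj₂ e ≤ 3 + j →
  mult e (cycEdges (nthD (p ++ [ i ])) (suc j)) + 𝟙 (eqPair e (edgeAt (cycEdges (nthD p) j) i))
    ≡ mult e (cycEdges (nthD p) j)
mult-old-snoc j p i e ok i< e≤ =
  subst₂ (λ s L → mult e (cycEdges (nthD (p ++ [ i ])) (suc j)) + 𝟙 (eqPair e s) ≡ mult e L)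
         (subdivided-snoc j p i ok) (cycEdges-snoc j p i ok)
         (mult-old-suc _ j e (proj₂ (ValidPrefix-snoc j p i ok i<)) e≤)

mult-new-snoc : ∀ j p i c → ValidPrefix j p → i < 3 + j →
  mult (c , 4 + j) (cycEdges (nthD (p ++ [ i ])) (suc j)) ≡ incidence c (edgeAt (cycEdges (nthD p) j) i)
mult-new-snoc j p i c ok i< =
  trans (mult-new-suc _ j c (proj₂ (ValidPrefix-snoc j p i ok i<))) (cong (incidence c) (subdivided-snoc j p i ok))

∑-prefixes-suc-const : ∀ j (F : List ℕ → ℕ) → (∀ p i → ValidPrefix j p → i < 3 + j → F (p ++ [ i ]) ≡ F p) →
  ∑ F (prefixes (suc j)) ≡ (3 + j) * ∑ F (prefixes j)
∑-prefixes-suc-const j F F-snoc = begin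
  ∑ F (prefixes (suc j))                                      ≡⟨ ∑-prefixes-suc j F ⟩
  ∑ (λ p → ∑ (λ i → F (p ++ [ i ])) (upTo (3 + j))) (prefixes j) ≡⟨ ∑-prefixes-cong j children ⟩
  ∑ (λ p → (3 + j) * F p) (prefixes j)                        ≡⟨ ∑-*ˡ (3 + j) F (prefixes j) ⟩
  (3 + j) * ∑ F (prefixes j)                                  ∎
  where
  open ≡-Reasoning
  children : ∀ p → ValidPrefix j p → ∑ (λ i → F (p ++ [ i ])) (upTo (3 + j)) ≡ (3 + j) * F p
  children p ok = begin
    ∑ (λ i → F (p ++ [ i ])) (upTo (3 + j)) ≡⟨ ∑-upTo-cong (3 + j) (λ i i< → F-snoc p i ok i<) ⟩
    ∑ (λ _ → F p) (upTo (3 + j))            ≡⟨ ∑-const (F p) (upTo (3 + j)) ⟩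
    F p * length (upTo (3 + j))             ≡⟨ cong (F p *_) (length-upTo (3 + j)) ⟩
    F p * (3 + j)                           ≡⟨ *-comm (F p) (3 + j) ⟩
    (3 + j) * F p                           ∎

∑-one : ∀ {A : Set} (xs : List A) → ∑ (λ _ → 1) xs ≡ length xs
∑-one xs = trans (∑-const 1 xs) (*-identityˡ (length xs))

length-prefixes-suc : ∀ j → length (prefixes (suc j)) ≡ (3 + j) * length (prefixes j)
length-prefixes-suc j = begin
  length (prefixes (suc j))          ≡⟨ ∑-one (prefixes (suc j)) ⟨
  ∑ (λ _ → 1) (prefixes (suc j))     ≡⟨ ∑-prefixes-suc-const j (λ _ → 1) (λ _ _ _ _ → refl) ⟩
  (3 + j) * ∑ (λ _ → 1) (prefixes j) ≡⟨ cong ((3 + j) *_) (∑-one (prefixes j)) ⟩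
  (3 + j) * length (prefixes j)      ∎
  where open ≡-Reasoning

length-prefixes : ∀ j → 2 * length (prefixes j) ≡ (2 + j) !
length-prefixes zero    = refl
length-prefixes (suc j) = begin
  2 * length (prefixes (suc j))     ≡⟨ cong (2 *_) (length-prefixes-suc j) ⟩
  2 * ((3 + j) * length (prefixes j)) ≡⟨ *-comm-middle 2 (3 + j) (length (prefixes j)) ⟩
  (3 + j) * (2 * length (prefixes j)) ≡⟨ cong ((3 + j) *_) (length-prefixes j) ⟩
  (3 + j) * (2 + j) !               ∎
  where
  open ≡-Reasoning

length-prefixes-pos : ∀ j → 1 ≤ length (prefixes j)
length-prefixes-pos zero    = ≤-refl
length-prefixes-pos (suc j) = subst (1 ≤_) (sym (length-prefixes-suc j)) (≤-trans (length-prefixes-pos j) (m≤m+n _ _))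

children-old : ∀ j p e → ValidPrefix j p → proj₂ e ≤ 3 + j →
  ∑ (λ i → mult e (cycEdges (nthD (p ++ [ i ])) (suc j))) (upTo (3 + j)) ≡ (2 + j) * mult e (cycEdges (nthD p) j)
children-old j p e ok e≤ = +-cancelʳ-≡ (mult e L) _ _ (begin
  ∑ F (upTo (3 + j)) + mult e L   ≡⟨ ∑-by-edges (nthD p) j F (λ f → 𝟙 (eqPair e f)) (λ _ → mult e L)
                                                 (λ i i< → mult-old-snoc j p i e ok i< e≤) ⟩
  ∑ (λ _ → mult e L) L             ≡⟨ ∑-const (mult e L) L ⟩
  mult e L * length L              ≡⟨ cong (mult e L *_) (length-cycEdges (nthD p) j) ⟩
  mult e L * (3 + j)               ≡⟨ *-comm (mult e L) (3 + j) ⟩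
  (3 + j) * mult e L               ≡⟨ +-comm (mult e L) _ ⟩
  (2 + j) * mult e L + mult e L    ∎)
  where
  open ≡-Reasoning
  L = cycEdges (nthD p) j
  F = λ i → mult e (cycEdges (nthD (p ++ [ i ])) (suc j))

children-new : ∀ j p c → ValidPrefix j p →
  ∑ (λ i → mult (c , 4 + j) (cycEdges (nthD (p ++ [ i ])) (suc j))) (upTo (3 + j)) ≡ degree c (cycEdges (nthD p) j)
children-new j p c ok =
  trans (∑-upTo-cong (3 + j) (λ i i< → mult-new-snoc j p i c ok i<)) (∑-cycEdges-indexed (nthD p) j (incidence c))

edgeFrequency : ℕ → Edge → ℕ
edgeFrequency j e = ∑ (λ p → mult e (cycEdges (nthD p) j)) (prefixes j)

edgeFrequency-valid : ∀ j e → ValidEdge (3 + j) e → edgeFrequency j e ≡ (1 + j) !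
edgeFrequency-valid zero    e e-valid = trans (+-identityʳ _) (mult-triangle (nthD []) e e-valid)
edgeFrequency-valid (suc j) e e-valid@(1≤e₁ , e₁<e₂ , e₂≤) with m≤n⇒m<n∨m≡n e₂≤
... | inj₁ (s≤s e₂≤3+j) = begin
  edgeFrequency (suc j) e                              ≡⟨ ∑-prefixes-suc j _ ⟩
  ∑ (λ p → ∑ (λ i → mult e (cycEdges (nthD (p ++ [ i ])) (suc j))) (upTo (3 + j))) (prefixes j)
                                                       ≡⟨ ∑-prefixes-cong j (λ p ok → children-old j p e ok e₂≤3+j) ⟩
  ∑ (λ p → (2 + j) * mult e (cycEdges (nthD p) j)) (prefixes j) ≡⟨ ∑-*ˡ (2 + j) _ (prefixes j) ⟩
  (2 + j) * edgeFrequency j e                          ≡⟨ cong ((2 + j) *_) (edgeFrequency-valid j e (1≤e₁ , e₁<e₂ , e₂≤3+j)) ⟩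
  (2 + j) !                                            ∎
  where open ≡-Reasoning
... | inj₂ e₂≡ = begin
  edgeFrequency (suc j) e                              ≡⟨ ∑-prefixes-suc j _ ⟩
  ∑ (λ p → ∑ (λ i → mult e (cycEdges (nthD (p ++ [ i ])) (suc j))) (upTo (3 + j))) (prefixes j)
                                                       ≡⟨ ∑-prefixes-cong j two-per-prefix ⟩
  ∑ (λ _ → 2) (prefixes j)                             ≡⟨ ∑-const 2 (prefixes j) ⟩
  2 * length (prefixes j)                              ≡⟨ length-prefixes j ⟩
  (2 + j) !                                            ∎
  where
  open ≡-Reasoning
  c = proj₁ e
  two-per-prefix : ∀ p → ValidPrefix j p → ∑ (λ i → mult e (cycEdges (nthD (p ++ [ i ])) (suc j))) (upTo (3 + j)) ≡ 2
  two-per-prefix p ok = begin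
    ∑ (λ i → mult e (cycEdges (nthD (p ++ [ i ])) (suc j))) (upTo (3 + j))
      ≡⟨ cong (λ t → ∑ (λ i → mult (c , t) (cycEdges (nthD (p ++ [ i ])) (suc j))) (upTo (3 + j))) e₂≡ ⟩
    ∑ (λ i → mult (c , 4 + j) (cycEdges (nthD (p ++ [ i ])) (suc j))) (upTo (3 + j))
      ≡⟨ children-new j p c ok ⟩
    degree c (cycEdges (nthD p) j)
      ≡⟨ regular (invariant (nthD p) j (proj₂ ok)) c 1≤e₁ (≤-pred (≤-trans e₁<e₂ (≤-reflexive e₂≡))) ⟩
    2 ∎

shared : Edge → Edge → ℕ
shared e f = incidence (proj₁ e) f + incidence (proj₂ e) f

shared-sym : ∀ e f → shared e f ≡ shared f e
shared-sym (a , b) (c , d) rewrite ≡ᵇ-sym a c | ≡ᵇ-sym a d | ≡ᵇ-sym b c | ≡ᵇ-sym b d =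
  interchange +-commutativeSemigroup (𝟙 (c ≡ᵇ a)) (𝟙 (d ≡ᵇ a)) (𝟙 (c ≡ᵇ b)) (𝟙 (d ≡ᵇ b))

shared-triangle : ∀ e f → ValidEdge 3 e → ValidEdge 3 f → e ≢ f → shared e f ≡ 1
shared-triangle e f e-valid f-valid e≢f with triangle-edge e e-valid | triangle-edge f f-valid
... | inj₁ refl        | inj₁ refl        = contradiction refl e≢f
... | inj₁ refl        | inj₂ (inj₁ refl) = refl
... | inj₁ refl        | inj₂ (inj₂ refl) = refl
... | inj₂ (inj₁ refl) | inj₁ refl        = refl
... | inj₂ (inj₁ refl) | inj₂ (inj₁ refl) = contradiction refl e≢f
... | inj₂ (inj₁ refl) | inj₂ (inj₂ refl) = refl
... | inj₂ (inj₂ refl) | inj₁ refl        = refl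
... | inj₂ (inj₂ refl) | inj₂ (inj₁ refl) = refl
... | inj₂ (inj₂ refl) | inj₂ (inj₂ refl) = contradiction refl e≢f

shared-new : ∀ j e c → ValidEdge (3 + j) e → shared e (c , 4 + j) ≡ incidence c e
shared-new j (a , b) c (_ , a<b , b≤)
  rewrite ≢⇒≡ᵇ-false a (4 + j) (<⇒≢ (s≤s (≤-trans (<⇒≤ a<b) b≤)))
        | ≢⇒≡ᵇ-false b (4 + j) (<⇒≢ (s≤s b≤)) | ≡ᵇ-sym a c | ≡ᵇ-sym b c =
  cong₂ _+_ (+-identityʳ (𝟙 (c ≡ᵇ a))) (+-identityʳ (𝟙 (c ≡ᵇ b)))

∑-𝟙-eqPair-* : ∀ e (w : Edge → ℕ) L → ∑ (λ f → 𝟙 (eqPair e f) * w f) L ≡ w e * mult e L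
∑-𝟙-eqPair-* e w []      = sym (*-zeroʳ (w e))
∑-𝟙-eqPair-* e w (f ∷ L) with eqPair e f in e≟f
... | true  rewrite eqPair-true⇒≡ e f e≟f | ∑-𝟙-eqPair-* f w L =
  trans (cong (_+ w f * mult f L) (+-identityʳ (w f))) (sym (*-suc (w f) (mult f L)))
... | false rewrite ∑-𝟙-eqPair-* e w L = refl

𝟙-eqPair-*-distinct : ∀ e e′ f → e ≢ e′ → 𝟙 (eqPair e f) * 𝟙 (eqPair e′ f) ≡ 0
𝟙-eqPair-*-distinct e e′ f e≢e′ with eqPair e f in e≟f
... | false = refl
... | true rewrite ≢⇒eqPair-false e′ f (λ e′≡f → e≢e′ (trans (eqPair-true⇒≡ e f e≟f) (sym e′≡f))) = refl

incidence-*-sorted : ∀ c c′ a b → a < b → c < c′ → incidence c (a , b) * incidence c′ (a , b) ≡ 𝟙 ((c ≡ᵇ a) ∧ (c′ ≡ᵇ b))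
incidence-*-sorted c c′ a b a<b c<c′ with c ≟ a
... | yes refl rewrite ≡ᵇ-refl c | ≢⇒≡ᵇ-false c b (<⇒≢ a<b) | ≢⇒≡ᵇ-false c′ c (>⇒≢ c<c′) = +-identityʳ _
... | no c≢a rewrite ≢⇒≡ᵇ-false c a c≢a with c ≟ b
...   | yes refl rewrite ≡ᵇ-refl c | ≢⇒≡ᵇ-false c′ a (>⇒≢ (<-trans a<b c<c′)) | ≢⇒≡ᵇ-false c′ c (>⇒≢ c<c′) = refl
...   | no c≢b rewrite ≢⇒≡ᵇ-false c b c≢b = refl

incidence-*-incidence : ∀ m c c′ f → ValidEdge m f → c ≢ c′ → incidence c f * incidence c′ f ≡ 𝟙 (eqPair (edge c c′) f)
incidence-*-incidence m c c′ (a , b) (_ , a<b , _) c≢c′ with <-cmp c c′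
... | tri< c<c′ _ _ rewrite m≤n⇒m⊓n≡m (<⇒≤ c<c′) | m≤n⇒m⊔n≡n (<⇒≤ c<c′) = incidence-*-sorted c c′ a b a<b c<c′
... | tri≈ _ c≡c′ _ = contradiction c≡c′ c≢c′
... | tri> _ _ c′<c rewrite *-comm (incidence c (a , b)) (incidence c′ (a , b))
                          | m≥n⇒m⊓n≡n (<⇒≤ c′<c) | m≥n⇒m⊔n≡m (<⇒≤ c′<c) = incidence-*-sorted c′ c a b a<b c′<c

edge-valid : ∀ m c c′ → 1 ≤ c → c ≤ m → 1 ≤ c′ → c′ ≤ m → c ≢ c′ → ValidEdge m (edge c c′)
edge-valid m c c′ 1≤c c≤m 1≤c′ c′≤m c≢c′ with <-cmp c c′
... | tri< c<c′ _ _ rewrite m≤n⇒m⊓n≡m (<⇒≤ c<c′) | m≤n⇒m⊔n≡n (<⇒≤ c<c′) = 1≤c , c<c′ , c′≤m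
... | tri≈ _ c≡c′ _ = contradiction c≡c′ c≢c′
... | tri> _ _ c′<c rewrite m≥n⇒m⊓n≡n (<⇒≤ c′<c) | m≥n⇒m⊔n≡m (<⇒≤ c′<c) = 1≤c′ , c′<c , c≤m

product-split : ∀ X u Y v → u * v ≡ 0 → X * Y + ((Y + v) * u + (X + u) * v) ≡ (X + u) * (Y + v)
product-split X u Y v uv≡0 = trans (expand X u Y v) (trans (cong ((X + u) * (Y + v) +_) uv≡0) (+-identityʳ _))
  where
  expand : ∀ X u Y v → X * Y + ((Y + v) * u + (X + u) * v) ≡ (X + u) * (Y + v) + u * v
  expand = solve-∀

module PrefixChildren (j : ℕ) (p : List ℕ) (ok : ValidPrefix j p) where
  private
    L = cycEdges (nthD p) j
    L′ : ℕ → List Edge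
    L′ i = cycEdges (nthD (p ++ [ i ])) (suc j)
    M : Edge → ℕ
    M e = mult e L
    open ≡-Reasoning

  children-old-old : ∀ e e′ → proj₂ e ≤ 3 + j → proj₂ e′ ≤ 3 + j → e ≢ e′ →
    ∑ (λ i → mult e (L′ i) * mult e′ (L′ i)) (upTo (3 + j)) ≡ (1 + j) * (M e * M e′)
  children-old-old e e′ e≤ e′≤ e≢e′ = +-cancelʳ-≡ (M e′ * M e + M e * M e′) _ _ (begin
    ∑ F (upTo (3 + j)) + (M e′ * M e + M e * M e′)        ≡⟨ cong (∑ F (upTo (3 + j)) +_) ∑A ⟨
    ∑ F (upTo (3 + j)) + ∑ A L                            ≡⟨ ∑-by-edges (nthD p) j F A (λ _ → M e * M e′) pointwise ⟩
    ∑ (λ _ → M e * M e′) L                                ≡⟨ ∑-const (M e * M e′) L ⟩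
    M e * M e′ * length L                                 ≡⟨ cong (M e * M e′ *_) (length-cycEdges (nthD p) j) ⟩
    M e * M e′ * (3 + j)                                  ≡⟨ regroup (M e) (M e′) j ⟩
    (1 + j) * (M e * M e′) + (M e′ * M e + M e * M e′)    ∎)
    where
    F = λ i → mult e (L′ i) * mult e′ (L′ i)
    A = λ f → M e′ * 𝟙 (eqPair e f) + M e * 𝟙 (eqPair e′ f)
    ∑A : ∑ A L ≡ M e′ * M e + M e * M e′
    ∑A = trans (∑-+ _ _ L) (cong₂ _+_ (∑-*ˡ (M e′) _ L) (∑-*ˡ (M e) _ L))
    regroup : ∀ a b j → a * b * (3 + j) ≡ (1 + j) * (a * b) + (b * a + a * b)
    regroup = solve-∀
    pointwise : ∀ i → i < 3 + j → F i + A (edgeAt L i) ≡ M e * M e′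
    pointwise i i< = begin
      X * Y + (M e′ * u + M e * v)         ≡⟨ cong₂ (λ s t → X * Y + (t * u + s * v)) X+u Y+v ⟨
      X * Y + ((Y + v) * u + (X + u) * v)  ≡⟨ product-split X u Y v (𝟙-eqPair-*-distinct e e′ (edgeAt L i) e≢e′) ⟩
      (X + u) * (Y + v)                    ≡⟨ cong₂ _*_ X+u Y+v ⟩
      M e * M e′                           ∎
      where
      X = mult e (L′ i)
      Y = mult e′ (L′ i)
      u = 𝟙 (eqPair e (edgeAt L i))
      v = 𝟙 (eqPair e′ (edgeAt L i))
      X+u = mult-old-snoc j p i e ok i< e≤
      Y+v = mult-old-snoc j p i e′ ok i< e′≤

  children-old-new : ∀ e c → proj₂ e ≤ 3 + j → 1 ≤ c → c ≤ 3 + j →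
    ∑ (λ i → mult e (L′ i) * mult (c , 4 + j) (L′ i)) (upTo (3 + j)) + incidence c e * M e ≡ M e * 2
  children-old-new e c e≤ 1≤c c≤ = begin
    ∑ F (upTo (3 + j)) + incidence c e * M e
      ≡⟨ cong (∑ F (upTo (3 + j)) +_) (∑-𝟙-eqPair-* e (incidence c) L) ⟨
    ∑ F (upTo (3 + j)) + ∑ (λ f → 𝟙 (eqPair e f) * incidence c f) L ≡⟨ ∑-by-edges (nthD p) j F _ _ pointwise ⟩
    ∑ (λ f → M e * incidence c f) L                                 ≡⟨ ∑-*ˡ (M e) (incidence c) L ⟩
    M e * degree c L
      ≡⟨ cong (M e *_) (regular (invariant (nthD p) j (proj₂ ok)) c 1≤c c≤) ⟩
    M e * 2                                                         ∎
    where
    F = λ i → mult e (L′ i) * mult (c , 4 + j) (L′ i)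
    pointwise : ∀ i → i < 3 + j →
      F i + 𝟙 (eqPair e (edgeAt L i)) * incidence c (edgeAt L i) ≡ M e * incidence c (edgeAt L i)
    pointwise i i< rewrite mult-new-snoc j p i c ok i< =
      trans (sym (*-distribʳ-+ (incidence c (edgeAt L i)) (mult e (L′ i)) _)) (cong (_* incidence c (edgeAt L i)) (mult-old-snoc j p i e ok i< e≤))

  children-new-new : ∀ c c′ → c ≢ c′ →
    ∑ (λ i → mult (c , 4 + j) (L′ i) * mult (c′ , 4 + j) (L′ i)) (upTo (3 + j)) ≡ mult (edge c c′) L
  children-new-new c c′ c≢c′ = begin
    ∑ (λ i → mult (c , 4 + j) (L′ i) * mult (c′ , 4 + j) (L′ i)) (upTo (3 + j))
      ≡⟨ ∑-upTo-cong (3 + j) (λ i i< → cong₂ _*_ (mult-new-snoc j p i c ok i<) (mult-new-snoc j p i c′ ok i<)) ⟩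
    ∑ (λ i → incidence c (edgeAt L i) * incidence c′ (edgeAt L i)) (upTo (3 + j))
      ≡⟨ ∑-cycEdges-indexed (nthD p) j (λ f → incidence c f * incidence c′ f) ⟩
    ∑ (λ f → incidence c f * incidence c′ f) L
      ≡⟨ ∑-congᴬ (valid (invariant (nthD p) j (proj₂ ok))) (λ f f-valid → incidence-*-incidence (3 + j) c c′ f f-valid c≢c′) ⟩
    mult (edge c c′) L ∎

open PrefixChildren

pairFrequency : ℕ → Edge → Edge → ℕ
pairFrequency j e f = ∑ (λ p → mult e (cycEdges (nthD p) j) * mult f (cycEdges (nthD p) j)) (prefixes j)

pairFrequency-sym : ∀ j e f → pairFrequency j e f ≡ pairFrequency j f e
pairFrequency-sym j e f = ∑-cong (prefixes j) (λ p → *-comm (mult e (cycEdges (nthD p) j)) _)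

pairFrequency-old-old : ∀ j e f → proj₂ e ≤ 3 + j → proj₂ f ≤ 3 + j → e ≢ f →
  pairFrequency (suc j) e f ≡ (1 + j) * pairFrequency j e f
pairFrequency-old-old j e f e≤ f≤ e≢f =
  trans (∑-prefixes-suc j _)
        (trans (∑-prefixes-cong j (λ p ok → children-old-old j p ok e f e≤ f≤ e≢f)) (∑-*ˡ (1 + j) _ (prefixes j)))

pairFrequency-old-new : ∀ j e c → ValidEdge (3 + j) e → 1 ≤ c → c ≤ 3 + j →
  pairFrequency (suc j) e (c , 4 + j) + (1 + j) ! * shared e (c , 4 + j) ≡ 2 * (1 + j) !
pairFrequency-old-new j e c e-valid 1≤c c≤ = begin
  pairFrequency (suc j) e (c , 4 + j) + (1 + j) ! * shared e (c , 4 + j)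
    ≡⟨ cong (pairFrequency (suc j) e (c , 4 + j) +_) (trans (cong ((1 + j) ! *_) (shared-new j e c e-valid)) (*-comm ((1 + j) !) (incidence c e))) ⟩
  pairFrequency (suc j) e (c , 4 + j) + incidence c e * (1 + j) !
    ≡⟨ cong₂ _+_ (∑-prefixes-suc j G) (cong (incidence c e *_) (sym (edgeFrequency-valid j e e-valid))) ⟩
  ∑ F (prefixes j) + incidence c e * edgeFrequency j e
    ≡⟨ cong (∑ F (prefixes j) +_) (∑-*ˡ (incidence c e) _ (prefixes j)) ⟨
  ∑ F (prefixes j) + ∑ (λ p → incidence c e * mult e (cycEdges (nthD p) j)) (prefixes j)
    ≡⟨ ∑-+ F _ (prefixes j) ⟨
  ∑ (λ p → F p + incidence c e * mult e (cycEdges (nthD p) j)) (prefixes j)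
    ≡⟨ ∑-prefixes-cong j (λ p ok → trans (children-old-new j p ok e c (proj₂ (proj₂ e-valid)) 1≤c c≤)
                                        (*-comm (mult e (cycEdges (nthD p) j)) 2)) ⟩
  ∑ (λ p → 2 * mult e (cycEdges (nthD p) j)) (prefixes j)
    ≡⟨ ∑-*ˡ 2 _ (prefixes j) ⟩
  2 * edgeFrequency j e
    ≡⟨ cong (2 *_) (edgeFrequency-valid j e e-valid) ⟩
  2 * (1 + j) ! ∎
  where
  open ≡-Reasoning
  G = λ q → mult e (cycEdges (nthD q) (suc j)) * mult (c , 4 + j) (cycEdges (nthD q) (suc j))
  F = λ p → ∑ (λ i → G (p ++ [ i ])) (upTo (3 + j))

pairFrequency-new-new : ∀ j c c′ → c ≢ c′ → pairFrequency (suc j) (c , 4 + j) (c′ , 4 + j) ≡ edgeFrequency j (edge c c′)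
pairFrequency-new-new j c c′ c≢c′ =
  trans (∑-prefixes-suc j _) (∑-prefixes-cong j (λ p ok → children-new-new j p ok c c′ c≢c′))

new-edge-start : ∀ j e → ValidEdge (4 + j) e → proj₂ e ≡ 4 + j → proj₁ e ≤ 3 + j
new-edge-start j e (_ , e₁<e₂ , _) e₂≡ = ≤-pred (≤-trans e₁<e₂ (≤-reflexive e₂≡))

old-edge : ∀ j e → ValidEdge (4 + j) e → proj₂ e ≤ 3 + j → ValidEdge (3 + j) e
old-edge j e (1≤e₁ , e₁<e₂ , _) e₂≤ = 1≤e₁ , e₁<e₂ , e₂≤

pairFrequency-valid : ∀ j e f → ValidEdge (3 + j) e → ValidEdge (3 + j) f → e ≢ f →
  pairFrequency j e f + j ! * shared e f ≡ 2 * j !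
pairFrequency-valid zero e f e-valid f-valid e≢f
  rewrite mult-triangle (nthD []) e e-valid | mult-triangle (nthD []) f f-valid
        | shared-triangle e f e-valid f-valid e≢f = refl
pairFrequency-valid (suc j) e f e-valid f-valid e≢f
  with m≤n⇒m<n∨m≡n (proj₂ (proj₂ e-valid)) | m≤n⇒m<n∨m≡n (proj₂ (proj₂ f-valid))
... | inj₁ (s≤s e₂≤) | inj₁ (s≤s f₂≤) = begin
  pairFrequency (suc j) e f + (1 + j) ! * shared e f
    ≡⟨ cong (_+ (1 + j) ! * shared e f) (pairFrequency-old-old j e f e₂≤ f₂≤ e≢f) ⟩
  (1 + j) * pairFrequency j e f + (1 + j) * j ! * shared e f
    ≡⟨ factor (1 + j) (pairFrequency j e f) (j !) (shared e f) ⟩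
  (1 + j) * (pairFrequency j e f + j ! * shared e f)
    ≡⟨ cong ((1 + j) *_) (pairFrequency-valid j e f (old-edge j e e-valid e₂≤) (old-edge j f f-valid f₂≤) e≢f) ⟩
  (1 + j) * (2 * j !)
    ≡⟨ *-comm-middle (1 + j) 2 (j !) ⟩
  2 * (1 + j) ! ∎
  where
  open ≡-Reasoning
  factor : ∀ n p t s → n * p + n * t * s ≡ n * (p + t * s)
  factor = solve-∀
... | inj₁ (s≤s e₂≤) | inj₂ f₂≡ =
  subst (λ t → pairFrequency (suc j) e t + (1 + j) ! * shared e t ≡ 2 * (1 + j) !) (sym (cong (proj₁ f ,_) f₂≡))
        (pairFrequency-old-new j e (proj₁ f) (old-edge j e e-valid e₂≤) (proj₁ f-valid) (new-edge-start j f f-valid f₂≡))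
... | inj₂ e₂≡ | inj₁ (s≤s f₂≤) =
  subst (λ t → pairFrequency (suc j) t f + (1 + j) ! * shared t f ≡ 2 * (1 + j) !) (sym (cong (proj₁ e ,_) e₂≡))
        (subst₂ (λ s t → s + (1 + j) ! * t ≡ 2 * (1 + j) !) (pairFrequency-sym (suc j) f (proj₁ e , 4 + j)) (shared-sym f (proj₁ e , 4 + j))
                (pairFrequency-old-new j f (proj₁ e) (old-edge j f f-valid f₂≤) (proj₁ e-valid) (new-edge-start j e e-valid e₂≡)))
... | inj₂ e₂≡ | inj₂ f₂≡ =
  subst₂ (λ s t → pairFrequency (suc j) s t + (1 + j) ! * shared s t ≡ 2 * (1 + j) !)
         (sym (cong (c ,_) e₂≡)) (sym (cong (c′ ,_) f₂≡)) (begin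
  pairFrequency (suc j) (c , 4 + j) (c′ , 4 + j) + (1 + j) ! * shared (c , 4 + j) (c′ , 4 + j)
    ≡⟨ cong₂ (λ s t → s + (1 + j) ! * t) (pairFrequency-new-new j c c′ c≢c′) shared-ends ⟩
  edgeFrequency j (edge c c′) + (1 + j) ! * 1
    ≡⟨ cong₂ _+_ (edgeFrequency-valid j (edge c c′) cc′-valid) (*-identityʳ _) ⟩
  (1 + j) ! + (1 + j) !
    ≡⟨ cong ((1 + j) ! +_) (+-identityʳ _) ⟨
  2 * (1 + j) ! ∎)
  where
  open ≡-Reasoning
  c = proj₁ e
  c′ = proj₁ f
  c≢c′ : c ≢ c′
  c≢c′ c≡c′ = e≢f (cong₂ _,_ c≡c′ (trans e₂≡ (sym f₂≡)))
  c≤ = new-edge-start j e e-valid e₂≡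
  c′≤ = new-edge-start j f f-valid f₂≡
  cc′-valid = edge-valid (3 + j) c c′ (proj₁ e-valid) c≤ (proj₁ f-valid) c′≤ c≢c′
  shared-ends : shared (c , 4 + j) (c′ , 4 + j) ≡ 1
  shared-ends rewrite ≢⇒≡ᵇ-false c c′ c≢c′ | ≢⇒≡ᵇ-false c (4 + j) (<⇒≢ (s≤s c≤))
                    | ≢⇒≡ᵇ-false (4 + j) c′ (>⇒≢ (s≤s c′≤)) | ≡ᵇ-refl j = refl

∑-others : ∀ a (w : Edge → ℕ) L → ∑ (λ e → 𝟙 (not (eqPair a e)) * w e) L + w a * mult a L ≡ ∑ w L
∑-others a w L = begin
  ∑ (λ e → 𝟙 (not (eqPair a e)) * w e) L + w a * mult a L
    ≡⟨ cong (∑ (λ e → 𝟙 (not (eqPair a e)) * w e) L +_) (∑-𝟙-eqPair-* a w L) ⟨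
  ∑ (λ e → 𝟙 (not (eqPair a e)) * w e) L + ∑ (λ e → 𝟙 (eqPair a e) * w e) L
    ≡⟨ ∑-+ _ _ L ⟨
  ∑ (λ e → 𝟙 (not (eqPair a e)) * w e + 𝟙 (eqPair a e) * w e) L
    ≡⟨ ∑-cong L (λ e → trans (sym (*-distribʳ-+ (w e) (𝟙 (not (eqPair a e))) (𝟙 (eqPair a e))))
                             (trans (cong (_* w e) (𝟙-not (eqPair a e))) (*-identityˡ (w e)))) ⟩
  ∑ w L ∎
  where open ≡-Reasoning

∑-mult-swap : ∀ (w : Edge → ℕ) L₁ L₂ → ∑ (λ e → w e * mult e L₂) L₁ ≡ ∑ (λ e → w e * mult e L₁) L₂
∑-mult-swap w L₁ L₂ = begin
  ∑ (λ e → w e * mult e L₂) L₁                              ≡⟨ ∑-cong L₁ (λ e → ∑-*ˡ (w e) _ L₂) ⟨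
  ∑ (λ e → ∑ (λ e′ → w e * 𝟙 (eqPair e e′)) L₂) L₁          ≡⟨ ∑-swap (λ e e′ → w e * 𝟙 (eqPair e e′)) L₁ L₂ ⟩
  ∑ (λ e′ → ∑ (λ e → w e * 𝟙 (eqPair e e′)) L₁) L₂          ≡⟨ ∑-cong L₂ (λ e′ → ∑-cong L₁ (symmetric e′)) ⟩
  ∑ (λ e′ → ∑ (λ e → w e′ * 𝟙 (eqPair e′ e)) L₁) L₂         ≡⟨ ∑-cong L₂ (λ e′ → ∑-*ˡ (w e′) _ L₁) ⟩
  ∑ (λ e′ → w e′ * mult e′ L₁) L₂                           ∎
  where
  open ≡-Reasoning
  symmetric : ∀ e′ e → w e * 𝟙 (eqPair e e′) ≡ w e′ * 𝟙 (eqPair e′ e)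
  symmetric e′ e with eqPair e e′ in e≟e′
  ... | false rewrite eqPair-sym e′ e | e≟e′ = trans (*-zeroʳ (w e)) (sym (*-zeroʳ (w e′)))
  ... | true  rewrite eqPair-true⇒≡ e e′ e≟e′ | eqPair-refl e′ = refl

𝟙-∈ᵇ : ∀ e L → mult e L ≤ 1 → 𝟙 (e ∈ᵇ L) ≡ mult e L
𝟙-∈ᵇ e L e≤1 with mult e L
... | 0 = refl
... | 1 = refl
... | suc (suc _) with s≤s () ← e≤1

-- The number of histories B_{J+3} in which I_{j+4} occurs.
isolatedCount : (ℕ → ℕ) → ℕ → ℕ → ℕ
isolatedCount f j J = ∑ (λ q → 𝟙 (isolatedEvent f (nthD q) (4 + j))) (prefixes J)

module IsolatedCount (f : ℕ → ℕ) (j : ℕ) (adm : Admissible f (suc j)) where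
  private
    LA = cycEdges f j
    a  = subdivided f j
    IA = invariant f j (Admissible-pred f j adm)
    a-valid : ValidEdge (3 + j) a
    a-valid = Admissible⇒subdivided-valid f j adm
    mult-a : mult a LA ≡ 1
    mult-a = ≤-antisym (simple IA a) (mult-edgeAt LA (f j) (index<length-cycEdges f j (adm j ≤-refl)))
    others : Edge → ℕ
    others e = 𝟙 (not (eqPair a e))
    open ≡-Reasoning

  isolated-snoc : ∀ p i → ValidPrefix j p → i < 3 + j →
    let e = edgeAt (cycEdges (nthD p) j) i in
    isolatedEvent f (nthD (p ++ [ i ])) (4 + j) ≡ not (eqPair a e) ∧ a ∈ᵇ cycEdges (nthD p) j ∧ e ∈ᵇ LA
  isolated-snoc p i ok i< =
    trans (isolated≡crossed f (nthD (p ++ [ i ])) j adm (proj₂ (ValidPrefix-snoc j p i ok i<)))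
          (cong₂ (λ L e → not (eqPair a e) ∧ a ∈ᵇ L ∧ e ∈ᵇ LA) (cycEdges-snoc j p i ok) (subdivided-snoc j p i ok))

  children-isolated : ∀ p → ValidPrefix j p →
    ∑ (λ i → 𝟙 (isolatedEvent f (nthD (p ++ [ i ])) (4 + j))) (upTo (3 + j))
      ≡ ∑ (λ e → others e * (mult a (cycEdges (nthD p) j) * mult e (cycEdges (nthD p) j))) LA
  children-isolated p ok = begin
    ∑ (λ i → 𝟙 (isolatedEvent f (nthD (p ++ [ i ])) (4 + j))) (upTo (3 + j))
      ≡⟨ ∑-upTo-cong (3 + j) (λ i i< → cong 𝟙 (isolated-snoc p i ok i<)) ⟩
    ∑ (λ i → 𝟙 (test (edgeAt L i))) (upTo (3 + j))
      ≡⟨ ∑-cycEdges-indexed (nthD p) j (λ e → 𝟙 (test e)) ⟩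
    ∑ (λ e → 𝟙 (test e)) L
      ≡⟨ ∑-cong L factorise ⟩
    ∑ (λ e → mult a L * (others e * mult e LA)) L
      ≡⟨ ∑-*ˡ (mult a L) _ L ⟩
    mult a L * ∑ (λ e → others e * mult e LA) L
      ≡⟨ cong (mult a L *_) (∑-mult-swap others L LA) ⟩
    mult a L * ∑ (λ e → others e * mult e L) LA
      ≡⟨ ∑-*ˡ (mult a L) _ LA ⟨
    ∑ (λ e → mult a L * (others e * mult e L)) LA
      ≡⟨ ∑-cong LA (λ e → *-comm-middle (mult a L) (others e) (mult e L)) ⟩
    ∑ (λ e → others e * (mult a L * mult e L)) LA ∎
    where
    L = cycEdges (nthD p) j
    test = λ e → not (eqPair a e) ∧ a ∈ᵇ L ∧ e ∈ᵇ LA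
    factorise : ∀ e → 𝟙 (test e) ≡ mult a L * (others e * mult e LA)
    factorise e rewrite 𝟙-∧ (not (eqPair a e)) (a ∈ᵇ L ∧ e ∈ᵇ LA) | 𝟙-∧ (a ∈ᵇ L) (e ∈ᵇ LA)
                      | 𝟙-∈ᵇ a L (simple (invariant (nthD p) j (proj₂ ok)) a) | 𝟙-∈ᵇ e LA (simple IA e) =
      *-comm-middle (others e) (mult a L) (mult e LA)

  isolatedCount-pairs : isolatedCount f j (suc j) ≡ ∑ (λ e → others e * pairFrequency j a e) LA
  isolatedCount-pairs = begin
    isolatedCount f j (suc j)
      ≡⟨ ∑-prefixes-suc j _ ⟩
    ∑ (λ p → ∑ (λ i → 𝟙 (isolatedEvent f (nthD (p ++ [ i ])) (4 + j))) (upTo (3 + j))) (prefixes j)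
      ≡⟨ ∑-prefixes-cong j children-isolated ⟩
    ∑ (λ p → ∑ (λ e → others e * (mult a (cycEdges (nthD p) j) * mult e (cycEdges (nthD p) j))) LA) (prefixes j)
      ≡⟨ ∑-swap _ (prefixes j) LA ⟩
    ∑ (λ e → ∑ (λ p → others e * (mult a (cycEdges (nthD p) j) * mult e (cycEdges (nthD p) j))) (prefixes j)) LA
      ≡⟨ ∑-cong LA (λ e → ∑-*ˡ (others e) _ (prefixes j)) ⟩
    ∑ (λ e → others e * pairFrequency j a e) LA ∎

  number-of-others : ∑ (λ e → others e * 1) LA ≡ 2 + j
  number-of-others = +-cancelʳ-≡ 1 _ _ (begin
    ∑ (λ e → others e * 1) LA + 1            ≡⟨ cong (∑ (λ e → others e * 1) LA +_) (trans (*-identityˡ _) mult-a) ⟨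
    ∑ (λ e → others e * 1) LA + 1 * mult a LA ≡⟨ ∑-others a (λ _ → 1) LA ⟩
    ∑ (λ _ → 1) LA                       ≡⟨ ∑-one LA ⟩
    length LA                            ≡⟨ length-cycEdges f j ⟩
    3 + j                                ≡⟨ +-comm 1 (2 + j) ⟩
    2 + j + 1                            ∎)

  shared-with-others : ∑ (λ e → others e * shared a e) LA ≡ 2
  shared-with-others = +-cancelʳ-≡ 2 _ _ (begin
    ∑ (λ e → others e * shared a e) LA + 2               ≡⟨ cong (∑ (λ e → others e * shared a e) LA +_) shared-a-a ⟨
    ∑ (λ e → others e * shared a e) LA + shared a a * mult a LA ≡⟨ ∑-others a (shared a) LA ⟩
    ∑ (shared a) LA                                       ≡⟨ ∑-+ (incidence (proj₁ a)) (incidence (proj₂ a)) LA ⟩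
    degree (proj₁ a) LA + degree (proj₂ a) LA
      ≡⟨ cong₂ _+_ (regular IA (proj₁ a) 1≤a₁ a₁≤) (regular IA (proj₂ a) 1≤a₂ a₂≤) ⟩
    4                                                     ∎)
    where
    a₁<a₂ = proj₁ (proj₂ a-valid)
    1≤a₁ = proj₁ a-valid
    a₂≤ = proj₂ (proj₂ a-valid)
    a₁≤ = ≤-trans (<⇒≤ a₁<a₂) a₂≤
    1≤a₂ = ≤-trans 1≤a₁ (<⇒≤ a₁<a₂)
    shared-a-a : shared a a * mult a LA ≡ 2
    shared-a-a rewrite mult-a | ≡ᵇ-refl (proj₁ a) | ≡ᵇ-refl (proj₂ a)
                     | ≢⇒≡ᵇ-false (proj₁ a) (proj₂ a) (<⇒≢ a₁<a₂)
                     | ≢⇒≡ᵇ-false (proj₂ a) (proj₁ a) (>⇒≢ a₁<a₂) = refl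

  isolatedCount-own : isolatedCount f j (suc j) ≡ 2 * (1 + j) !
  isolatedCount-own = +-cancelʳ-≡ (j ! * 2) _ _ (begin
    isolatedCount f j (suc j) + j ! * 2
      ≡⟨ cong₂ _+_ isolatedCount-pairs (cong (j ! *_) (sym shared-with-others)) ⟩
    ∑ (λ e → others e * pairFrequency j a e) LA + j ! * ∑ (λ e → others e * shared a e) LA
      ≡⟨ cong (∑ (λ e → others e * pairFrequency j a e) LA +_) (∑-*ˡ (j !) _ LA) ⟨
    ∑ (λ e → others e * pairFrequency j a e) LA + ∑ (λ e → j ! * (others e * shared a e)) LA
      ≡⟨ ∑-+ _ _ LA ⟨
    ∑ (λ e → others e * pairFrequency j a e + j ! * (others e * shared a e)) LA
      ≡⟨ ∑-congᴬ (valid IA) per-edge ⟩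
    ∑ (λ e → 2 * j ! * (others e * 1)) LA
      ≡⟨ ∑-*ˡ (2 * j !) _ LA ⟩
    2 * j ! * ∑ (λ e → others e * 1) LA
      ≡⟨ cong (2 * j ! *_) number-of-others ⟩
    2 * j ! * (2 + j)
      ≡⟨ regroup (j !) j ⟩
    2 * (1 + j) ! + j ! * 2 ∎)
    where
    regroup : ∀ t j → 2 * t * (2 + j) ≡ 2 * ((1 + j) * t) + t * 2
    regroup = solve-∀
    per-edge : ∀ e → ValidEdge (3 + j) e →
      others e * pairFrequency j a e + j ! * (others e * shared a e) ≡ 2 * j ! * (others e * 1)
    per-edge e e-valid with eqPair a e in a≟e
    ... | true  = trans (*-zeroʳ (j !)) (sym (*-zeroʳ (2 * j !)))
    ... | false = begin
      pairFrequency j a e + 0 + j ! * (shared a e + 0) ≡⟨ cong₂ (λ s t → s + j ! * t) (+-identityʳ _) (+-identityʳ _) ⟩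
      pairFrequency j a e + j ! * shared a e           ≡⟨ pairFrequency-valid j a e a-valid e-valid a≢e ⟩
      2 * j !                                          ≡⟨ *-identityʳ _ ⟨
      2 * j ! * 1                                      ∎
      where
      a≢e : a ≢ e
      a≢e a≡e = contradiction (trans (sym a≟e) (subst (λ t → eqPair a t ≡ true) a≡e (eqPair-refl a))) λ ()

open IsolatedCount using (isolatedCount-own)

crossed-cong : ∀ f g g′ j → (∀ k → k < suc j → g k ≡ g′ k) → crossed f g j ≡ crossed f g′ j
crossed-cong f g g′ j g≗g′ =
  cong₂ (λ L e → not (eqPair (subdivided f j) e) ∧ subdivided f j ∈ᵇ L ∧ e ∈ᵇ cycEdges f j)
        L≡ (cong₂ edgeAt L≡ (g≗g′ j ≤-refl))
  where
  L≡ : cycEdges g j ≡ cycEdges g′ j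
  L≡ = cong cycleEdges (cycAux-cong g g′ j (λ k k<j → g≗g′ k (≤-trans k<j (n≤1+n j))))

isolated-snoc-later : ∀ f j J p i → Admissible f (suc j) → ValidPrefix J p → suc j ≤ J → i < 3 + J →
  isolatedEvent f (nthD (p ++ [ i ])) (4 + j) ≡ isolatedEvent f (nthD p) (4 + j)
isolated-snoc-later f j J p i adm ok@(len , admp) sj≤J i< = begin
  isolatedEvent f (nthD (p ++ [ i ])) (4 + j)
    ≡⟨ isolated≡crossed f _ j adm (Admissible-mono _ (≤-trans sj≤J (n≤1+n J)) (proj₂ (ValidPrefix-snoc J p i ok i<))) ⟩
  crossed f (nthD (p ++ [ i ])) j
    ≡⟨ crossed-cong f _ _ j (λ k k<sj → nthD-++ p [ i ] k (subst (k <_) (sym len) (≤-trans k<sj sj≤J))) ⟩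
  crossed f (nthD p) j                        ≡⟨ isolated≡crossed f _ j adm (Admissible-mono _ sj≤J admp) ⟨
  isolatedEvent f (nthD p) (4 + j)            ∎
  where open ≡-Reasoning

isolatedCount-ratio : ∀ f j J → Admissible f (suc j) → suc j ≤ J →
  isolatedCount f j J * ((3 + j) * (2 + j)) ≡ 4 * length (prefixes J)
isolatedCount-ratio f j (suc J) adm sj≤sJ with m≤n⇒m<n∨m≡n sj≤sJ
... | inj₂ refl = begin
  isolatedCount f j (suc j) * ((3 + j) * (2 + j)) ≡⟨ cong (_* ((3 + j) * (2 + j))) (isolatedCount-own f j adm) ⟩
  2 * (1 + j) ! * ((3 + j) * (2 + j))            ≡⟨ regroup ((1 + j) !) j ⟩
  2 * (3 + j) !                                   ≡⟨ cong (2 *_) (length-prefixes (suc j)) ⟨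
  2 * (2 * length (prefixes (suc j)))             ≡⟨ *-assoc 2 2 (length (prefixes (suc j))) ⟨
  4 * length (prefixes (suc j))                   ∎
  where
  open ≡-Reasoning
  regroup : ∀ t j → 2 * t * ((3 + j) * (2 + j)) ≡ 2 * ((3 + j) * ((2 + j) * t))
  regroup = solve-∀
... | inj₁ (s≤s sj≤J) = begin
  isolatedCount f j (suc J) * r
    ≡⟨ cong (_* r) (∑-prefixes-suc-const J _ (λ p i ok i< → cong 𝟙 (isolated-snoc-later f j J p i adm ok sj≤J i<))) ⟩
  (3 + J) * isolatedCount f j J * r             ≡⟨ *-assoc (3 + J) (isolatedCount f j J) r ⟩
  (3 + J) * (isolatedCount f j J * r)           ≡⟨ cong ((3 + J) *_) (isolatedCount-ratio f j J adm sj≤J) ⟩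
  (3 + J) * (4 * length (prefixes J))           ≡⟨ *-comm-middle (3 + J) 4 (length (prefixes J)) ⟩
  4 * ((3 + J) * length (prefixes J))           ≡⟨ cong (4 *_) (length-prefixes-suc J) ⟨
  4 * length (prefixes (suc J))                 ∎
  where
  open ≡-Reasoning
  r = (3 + j) * (2 + j)

-- The tail of the series

∑-upTo-zero : ∀ (W : ℕ → ℕ) M → (∀ n → n < M → W n ≡ 0) → ∑ W (upTo M) ≡ 0
∑-upTo-zero W M W≡0 = trans (∑-upTo-cong M W≡0) (trans (∑-const 0 (upTo M)) (*-zeroˡ (length (upTo M))))

-- If the terms vanish below 2 + a and beyond are 4L / ((n - 1)(n - 2)), the sum telescopes
-- to 4L (1/a - 1/(N - 1)); we only need the bound 4L / a.
module TailBound (W : ℕ → ℕ) (a L N : ℕ) (1≤a : 1 ≤ a)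
  (W-below : ∀ n → n ≤ N → n < 2 + a → W n ≡ 0)
  (W-small : ∀ n → n ≤ N → n < 4 → W n ≡ 0)
  (W-tail  : ∀ n → n ≤ N → 4 ≤ n → 2 + a ≤ n → W n * ((n ∸ 1) * (n ∸ 2)) ≡ 4 * L) where

  private
    S : ℕ → ℕ
    S k = ∑ W (upTo (k + (2 + a)))

    k+a≢0 : ∀ k → NonZero (k + a)
    k+a≢0 k = ≢-nonZero (λ k+a≡0 → <⇒≱ 1≤a (≤-trans (m≤n+m a k) (≤-reflexive k+a≡0)))

  partial-bound : ∀ k → k + (1 + a) ≤ N → a * (k + a) * S k + 4 * L * a ≤ 4 * L * (k + a)
  partial-bound zero    1+a≤N
    rewrite ∑-upTo-zero W (2 + a) (λ n n< → W-below n (≤-trans (≤-pred n<) 1+a≤N) n<) | *-zeroʳ (a * a) = ≤-refl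
  partial-bound (suc k) sk+1+a≤N with 4 ≤? k + (2 + a)
  ... | no n≱4 rewrite ∑-upTo-zero W (suc k + (2 + a))
                         (λ n n< → W-small n (≤-trans (≤-pred n<) (≤-trans (≤-reflexive (+-suc k (1 + a))) sk+1+a≤N))
                                             (≤-<-trans (≤-pred n<) (≰⇒> n≱4)))
                     | *-zeroʳ (a * (suc k + a)) = *-monoʳ-≤ (4 * L) (m≤n+m a (suc k))
  ... | yes n≥4 = *-cancelˡ-≤ (k + a) {{k+a≢0 k}} (begin
    (k + a) * (a * (suc k + a) * S (suc k) + 4 * L * a)
      ≡⟨ cong (λ t → (k + a) * (a * (suc k + a) * t + 4 * L * a)) (∑-upTo-suc W n) ⟩
    (k + a) * (a * (suc k + a) * (S k + w) + 4 * L * a)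
      ≡⟨ expand a k (S k) w L ⟩
    suc (k + a) * (a * (k + a) * S k) + a * (w * (suc (k + a) * (k + a))) + 4 * L * a * (k + a)
      ≡⟨ cong (λ t → suc (k + a) * (a * (k + a) * S k) + a * t + 4 * L * a * (k + a)) w-term ⟩
    suc (k + a) * (a * (k + a) * S k) + a * (4 * L) + 4 * L * a * (k + a)
      ≡⟨ collect a k (S k) L ⟩
    suc (k + a) * (a * (k + a) * S k + 4 * L * a)
      ≤⟨ *-monoʳ-≤ (suc (k + a)) (partial-bound k (≤-trans (n≤1+n _) sk+1+a≤N)) ⟩
    suc (k + a) * (4 * L * (k + a))
      ≡⟨ shift a k L ⟩
    (k + a) * (4 * L * (suc k + a)) ∎)
    where
    open ≤-Reasoning
    n = k + (2 + a)
    w = W n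
    n≤N : n ≤ N
    n≤N = ≤-trans (≤-reflexive (+-suc k (1 + a))) sk+1+a≤N
    w-term : w * (suc (k + a) * (k + a)) ≡ 4 * L
    w-term = trans (cong (λ t → w * t) (cong₂ _*_ (trans (sym (+-suc k a)) (sym (+-∸-assoc k (s≤s z≤n))))
                                                  (sym (+-∸-assoc k (s≤s (s≤s z≤n))))))
                   (W-tail n n≤N n≥4 (m≤n+m (2 + a) k))
    expand : ∀ a k S w L → (k + a) * (a * (suc k + a) * (S + w) + 4 * L * a)
      ≡ suc (k + a) * (a * (k + a) * S) + a * (w * (suc (k + a) * (k + a))) + 4 * L * a * (k + a)
    expand = solve-∀
    collect : ∀ a k S L → suc (k + a) * (a * (k + a) * S) + a * (4 * L) + 4 * L * a * (k + a)
      ≡ suc (k + a) * (a * (k + a) * S + 4 * L * a)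
    collect = solve-∀
    shift : ∀ a k L → suc (k + a) * (4 * L * (k + a)) ≡ (k + a) * (4 * L * (suc k + a))
    shift = solve-∀

  tail-bound : a * ∑ W (upTo (suc N)) ≤ 4 * L
  tail-bound with 1 + a ≤? N
  ... | no N<1+a rewrite ∑-upTo-zero W (suc N) (λ n n≤N → W-below n (≤-pred n≤N) (≤-<-trans (≤-pred n≤N) (m<n⇒m<1+n (≰⇒> N<1+a))))
                       | *-zeroʳ a = z≤n
  ... | yes 1+a≤N = *-cancelˡ-≤ (k + a) {{k+a≢0 k}} (begin
    (k + a) * (a * ∑ W (upTo (suc N)))          ≡⟨ cong (λ t → (k + a) * (a * ∑ W (upTo t))) N≡ ⟨
    (k + a) * (a * S k)                         ≡⟨ regroup (k + a) a (S k) ⟩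
    a * (k + a) * S k                           ≤⟨ m≤m+n _ (4 * L * a) ⟩
    a * (k + a) * S k + 4 * L * a               ≤⟨ partial-bound k (≤-reflexive (m∸n+n≡m 1+a≤N)) ⟩
    4 * L * (k + a)                             ≡⟨ *-comm (4 * L) (k + a) ⟩
    (k + a) * (4 * L)                           ∎)
    where
    open ≤-Reasoning
    k = N ∸ (1 + a)
    N≡ : k + (2 + a) ≡ suc N
    N≡ = trans (+-suc k (1 + a)) (cong suc (m∸n+n≡m 1+a≤N))
    regroup : ∀ x y z → x * (y * z) ≡ y * x * z
    regroup = solve-∀

countTrue-map : ∀ {A : Set} (E : A → Bool) xs → countTrue (map E xs) ≡ ∑ (λ x → 𝟙 (E x)) xs
countTrue-map E []       = refl
countTrue-map E (x ∷ xs) with E x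
... | true  = cong suc (countTrue-map E xs)
... | false = countTrue-map E xs

𝟙-anyB≤∑ : ∀ {A : Set} (g : A → Bool) xs → 𝟙 (anyB (map g xs)) ≤ ∑ (λ x → 𝟙 (g x)) xs
𝟙-anyB≤∑ g []       = z≤n
𝟙-anyB≤∑ g (x ∷ xs) with g x
... | true  = s≤s z≤n
... | false = 𝟙-anyB≤∑ g xs

union-bound : ∀ {A B : Set} (h : A → B → Bool) xs ys →
  countTrue (map (λ x → anyB (map (h x) ys)) xs) ≤ ∑ (λ y → ∑ (λ x → 𝟙 (h x y)) xs) ys
union-bound h xs ys = begin
  countTrue (map (λ x → anyB (map (h x) ys)) xs) ≡⟨ countTrue-map (λ x → anyB (map (h x) ys)) xs ⟩
  ∑ (λ x → 𝟙 (anyB (map (h x) ys))) xs           ≤⟨ ∑-mono xs (λ x → 𝟙-anyB≤∑ (h x) ys) ⟩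
  ∑ (λ x → ∑ (λ y → 𝟙 (h x y)) ys) xs            ≡⟨ ∑-swap (λ x y → 𝟙 (h x y)) xs ys ⟩
  ∑ (λ y → ∑ (λ x → 𝟙 (h x y)) xs) ys            ∎
  where open ≤-Reasoning

choices-admissible : ∀ (A : EvolvingCycle) j → Admissible (choices A) j
choices-admissible A j k _ = toℕ<n (A k)

≰⇒≤ᵇ-false : ∀ m n → n < m → (m ≤ᵇ n) ≡ false
≰⇒≤ᵇ-false m n n<m with m ≤ᵇ n in m≤ᵇn
... | false = refl
... | true  = contradiction (≤ᵇ⇒≤ m n (from T-≡ m≤ᵇn)) (<⇒≱ n<m)

module UnionCount (A : EvolvingCycle) (n₀ N : ℕ) (3≤n₀ : 3 ≤ n₀) where
  private
    f = choices A
    J = N ∸ 3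
    occurs : List ℕ → ℕ → Bool
    occurs p n = (4 ≤ᵇ n) ∧ (n₀ ≤ᵇ n) ∧ isolatedEvent f (nthD p) n
    W : ℕ → ℕ
    W n = ∑ (λ p → 𝟙 (occurs p n)) (prefixes J)
    a = n₀ ∸ 2
    1≤a : 1 ≤ a
    1≤a = ∸-monoˡ-≤ 2 3≤n₀
    a+2≡n₀ : 2 + a ≡ n₀
    a+2≡n₀ = trans (+-comm 2 a) (m∸n+n≡m (≤-trans (n≤1+n 2) 3≤n₀))

    W-below : ∀ n → n ≤ N → n < 2 + a → W n ≡ 0
    W-below n _ n<2+a = trans (∑-cong (prefixes J) absent) (∑-const 0 (prefixes J))
      where
      absent : ∀ p → 𝟙 (occurs p n) ≡ 0
      absent p rewrite ≰⇒≤ᵇ-false n₀ n (subst (n <_) a+2≡n₀ n<2+a) = cong 𝟙 (∧-zeroʳ (4 ≤ᵇ n))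

    W-small : ∀ n → n ≤ N → n < 4 → W n ≡ 0
    W-small n _ n<4 = trans (∑-cong (prefixes J) absent) (∑-const 0 (prefixes J))
      where
      absent : ∀ p → 𝟙 (occurs p n) ≡ 0
      absent p rewrite ≰⇒≤ᵇ-false 4 n n<4 = refl

    W-tail : ∀ n → n ≤ N → 4 ≤ n → 2 + a ≤ n → W n * ((n ∸ 1) * (n ∸ 2)) ≡ 4 * length (prefixes J)
    W-tail n n≤N 4≤n 2+a≤n = subst (λ t → W t * ((t ∸ 1) * (t ∸ 2)) ≡ 4 * length (prefixes J)) n≡
      (trans (cong (_* ((3 + j) * (2 + j))) counts) (isolatedCount-ratio f j J (choices-admissible A (suc j)) sj≤J))
      where
      j = n ∸ 4
      n≡ : 4 + j ≡ n
      n≡ = m+[n∸m]≡n 4≤n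
      sj≤J : suc j ≤ J
      sj≤J = ∸-monoˡ-≤ 3 (≤-trans (≤-reflexive n≡) n≤N)
      n₀≤n : (n₀ ≤ᵇ 4 + j) ≡ true
      n₀≤n = to T-≡ (≤⇒≤ᵇ (subst₂ _≤_ a+2≡n₀ (sym n≡) 2+a≤n))
      counts : W (4 + j) ≡ isolatedCount f j J
      counts = ∑-cong (prefixes J) (λ p → cong (λ b → 𝟙 (b ∧ isolatedEvent f (nthD p) (4 + j))) n₀≤n)

  open TailBound W a (length (prefixes J)) N 1≤a W-below W-small W-tail

  union-count : a * countTrue (map (λ p → anyB (map (occurs p) (upTo (suc N)))) (prefixes J)) ≤ 4 * length (prefixes J)
  union-count = ≤-trans (*-monoʳ-≤ a (union-bound occurs (prefixes J) (upTo (suc N)))) tail-bound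

-- Imported only here: the prefix operator +_ would make the sections (n +_) above ambiguous.
open import Data.Integer using (+_)

-- fracᵘ a d is the unnormalised rational a / (1 + d).
fracᵘ : ℕ → ℕ → ℚᵘ.ℚᵘ
fracᵘ a d = ℚᵘ.mkℚᵘ (+ a) d

fracᵘ-≤ : ∀ a d c e → a * suc e ≤ c * suc d → fracᵘ a d ℚᵘ.≤ fracᵘ c e
fracᵘ-≤ a d c e ≤′ = ℚᵘ.*≤* (subst₂ ℤ._≤_ (ℤ.pos-* a (suc e)) (ℤ.pos-* c (suc d)) (ℤ.+≤+ ≤′))

fracᵘ-≤⁻ : ∀ a d c e → fracᵘ a d ℚᵘ.≤ fracᵘ c e → a * suc e ≤ c * suc d
fracᵘ-≤⁻ a d c e (ℚᵘ.*≤* ≤′) = ℤ.drop‿+≤+ (subst₂ ℤ._≤_ (sym (ℤ.pos-* a (suc e))) (sym (ℤ.pos-* c (suc d))) ≤′)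

fracᵘ-< : ∀ a d c e → a * suc e < c * suc d → fracᵘ a d ℚᵘ.< fracᵘ c e
fracᵘ-< a d c e <′ = ℚᵘ.*<* (subst₂ ℤ._<_ (ℤ.pos-* a (suc e)) (ℤ.pos-* c (suc d)) (ℤ.+<+ <′))

fracᵘ-+ : ∀ a d c e b g → (a * suc e + c * suc d) * suc g ≡ b * (suc d * suc e) →
  fracᵘ a d ℚᵘ.+ fracᵘ c e ℚᵘ.≃ fracᵘ b g
fracᵘ-+ a d c e b g cross = ℚᵘ.*≡* (begin
  (+ a ℤ.* + suc e ℤ.+ + c ℤ.* + suc d) ℤ.* + suc g
    ≡⟨ cong₂ (λ s t → (s ℤ.+ t) ℤ.* + suc g) (ℤ.pos-* a (suc e)) (ℤ.pos-* c (suc d)) ⟨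
  + (a * suc e + c * suc d) ℤ.* + suc g             ≡⟨ ℤ.pos-* (a * suc e + c * suc d) (suc g) ⟨
  + ((a * suc e + c * suc d) * suc g)               ≡⟨ cong +_ cross ⟩
  + (b * (suc d * suc e))                           ≡⟨ ℤ.pos-* b (suc d * suc e) ⟩
  + b ℤ.* + (suc d * suc e)                         ∎)
  where open ≡-Reasoning

frac≃fracᵘ : ∀ a d → ℚ.toℚᵘ (frac a (suc d)) ℚᵘ.≃ fracᵘ a d
frac≃fracᵘ a d = ℚ.toℚᵘ-fromℚᵘ (fracᵘ a d)

frac-nonneg : ∀ a d → 0ℚ ≤ℚ frac a (suc d)
frac-nonneg a d = ℚ.toℚᵘ-cancel-≤ (ℚᵘ.≤-respʳ-≃ (ℚᵘ.≃-sym (frac≃fracᵘ a d)) (fracᵘ-≤ 0 0 a d z≤n))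

frac-≤ : ∀ a T ε c e → 1 ≤ T → ℚ.toℚᵘ ε ≡ fracᵘ c e → a * suc e ≤ c * T → frac a T ≤ℚ ε
frac-≤ a (suc d) ε c e _ ε≡ ≤′ =
  ℚ.toℚᵘ-cancel-≤ (ℚᵘ.≤-respˡ-≃ (ℚᵘ.≃-sym (frac≃fracᵘ a d))
                                (subst (fracᵘ a d ℚᵘ.≤_) (sym ε≡) (fracᵘ-≤ a d c e ≤′)))

frac-< : ∀ a d ε c e → ℚ.toℚᵘ ε ≡ fracᵘ c e → a * suc e < c * suc d → frac a (suc d) <ℚ ε
frac-< a d ε c e ε≡ <′ =
  ℚ.toℚᵘ-cancel-< (ℚᵘ.<-respˡ-≃ (ℚᵘ.≃-sym (frac≃fracᵘ a d))
                                (subst (fracᵘ a d ℚᵘ.<_) (sym ε≡) (fracᵘ-< a d c e <′)))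

threshold-bound : ∀ ε pos n₀ → threshold ε pos ≤ℚ + n₀ / 1 →
  4 * ℚ.↧ₙ ε + 2 * ℤ.∣ ℚ.↥ ε ∣ ≤ n₀ * ℤ.∣ ℚ.↥ ε ∣
threshold-bound (ℚ.mkℚ (+ 0) _ _)      (ℚ.*<* (ℤ.+<+ ())) _ _
threshold-bound (ℚ.mkℚ ℤ.-[1+ _ ] _ _) (ℚ.*<* ())         _ _
threshold-bound ε@(ℚ.mkℚ (+ suc p) q _) pos n₀ thr = subst (_≤ n₀ * suc p) (*-identityʳ _)
  (fracᵘ-≤⁻ _ p n₀ 0 (ℚᵘ.≤-respʳ-≃ (ℚ.toℚᵘ-fromℚᵘ (fracᵘ n₀ 0))
                                   (ℚᵘ.≤-respˡ-≃ threshold≃ (ℚ.toℚᵘ-mono-≤ thr))))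
  where
  instance _ = ℚ.>-nonZero pos
  cross : ∀ p q → (4 * suc q * 1 + 2 * suc (p + 0 * suc p)) * suc p ≡ (4 * suc q + 2 * suc p) * (suc (p + 0 * suc p) * 1)
  cross = solve-∀
  threshold≃ : ℚ.toℚᵘ (threshold ε pos) ℚᵘ.≃ fracᵘ (4 * suc q + 2 * suc p) p
  threshold≃ = ℚᵘ.≃-trans (ℚ.toℚᵘ-homo-+ (+ 4 / 1 ÷ ε) (+ 2 / 1))
                 (ℚᵘ.≃-trans (ℚᵘ.+-cong (ℚ.toℚᵘ-homo-* (+ 4 / 1) (ℚ.1/ ε)) (ℚᵘ.≃-refl {fracᵘ 2 0}))
                             (ℚᵘ.*≡* (cong +_ (cross p q))))

scaled-bound : ∀ u t a s r → a * u ≤ 4 * t → 4 * r ≤ a * s → u * r ≤ s * t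
scaled-bound u t a s r au≤4t 4r≤as = *-cancelˡ-≤ 4 (begin
  4 * (u * r)   ≡⟨ *-comm-middle 4 u r ⟩
  u * (4 * r)   ≤⟨ *-monoʳ-≤ u 4r≤as ⟩
  u * (a * s)   ≡⟨ *-comm-middle u a s ⟩
  a * (u * s)   ≡⟨ *-assoc a u s ⟨
  a * u * s     ≤⟨ *-monoˡ-≤ s au≤4t ⟩
  4 * t * s     ≡⟨ trans (*-assoc 4 t s) (cong (4 *_) (*-comm t s)) ⟩
  4 * (s * t)   ∎)
  where open ≤-Reasoning

probUnion-bound : ∀ (A : EvolvingCycle) ε (pos : 0ℚ <ℚ ε) n₀ → threshold ε pos ≤ℚ + n₀ / 1 →
  ∀ N → probUnion A n₀ N ≤ℚ ε
probUnion-bound A (ℚ.mkℚ (+ 0) _ _)      (ℚ.*<* (ℤ.+<+ ())) _ _ _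
probUnion-bound A (ℚ.mkℚ ℤ.-[1+ _ ] _ _) (ℚ.*<* ())         _ _ _
probUnion-bound A ε@(ℚ.mkℚ (+ suc p) q _) pos n₀ thr N =
  frac-≤ _ (length (prefixes (N ∸ 3))) ε (suc p) q (length-prefixes-pos (N ∸ 3)) refl
         (scaled-bound _ _ (n₀ ∸ 2) (suc p) (suc q) union-count 4q≤as)
  where
  thr′ = threshold-bound ε pos n₀ thr
  3≤n₀ : 3 ≤ n₀
  3≤n₀ with 3 ≤? n₀
  ... | yes 3≤n₀ = 3≤n₀
  ... | no 3≰n₀ = contradiction thr′ (<⇒≱ (≤-<-trans (*-monoˡ-≤ (suc p) (≤-pred (≰⇒> 3≰n₀))) (m<n+m (2 * suc p) (s≤s z≤n))))
  open UnionCount A n₀ N 3≤n₀ using (union-count)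
  4q≤as : 4 * suc q ≤ (n₀ ∸ 2) * suc p
  4q≤as = +-cancelʳ-≤ (2 * suc p) _ _ (≤-trans thr′ (≤-reflexive (begin-equality
    n₀ * suc p                          ≡⟨ cong (_* suc p) (m∸n+n≡m (≤-trans (n≤1+n 2) 3≤n₀)) ⟨
    (n₀ ∸ 2 + 2) * suc p                ≡⟨ *-distribʳ-+ (suc p) (n₀ ∸ 2) 2 ⟩
    (n₀ ∸ 2) * suc p + 2 * suc p        ∎)))
    where open ≤-Reasoning

frac-telescope : ∀ c T k → 1 ≤ T → c * ((3 + k) * (2 + k)) ≡ 4 * T → frac c T ℚ.+ frac 4 (3 + k) ≡ frac 4 (2 + k)
frac-telescope c (suc d) k _ c-ratio = ℚ.toℚᵘ-injective (begin
  ℚ.toℚᵘ (frac c (suc d) ℚ.+ frac 4 (3 + k))          ≈⟨ ℚ.toℚᵘ-homo-+ (frac c (suc d)) (frac 4 (3 + k)) ⟩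
  ℚ.toℚᵘ (frac c (suc d)) ℚᵘ.+ ℚ.toℚᵘ (frac 4 (3 + k)) ≈⟨ ℚᵘ.+-cong (frac≃fracᵘ c d) (frac≃fracᵘ 4 (2 + k)) ⟩
  fracᵘ c d ℚᵘ.+ fracᵘ 4 (2 + k)                       ≈⟨ fracᵘ-+ c d 4 (2 + k) 4 (1 + k) cross ⟩
  fracᵘ 4 (1 + k)                                      ≈⟨ frac≃fracᵘ 4 (1 + k) ⟨
  ℚ.toℚᵘ (frac 4 (2 + k))                              ∎)
  where
  open ℚᵘ.≃-Reasoning
  cross : (c * (3 + k) + 4 * suc d) * (2 + k) ≡ 4 * (suc d * (3 + k))
  cross = trans (expand c (suc d) k) (trans (cong (_+ 4 * suc d * (2 + k)) c-ratio) (collect (suc d) k))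
    where
    expand : ∀ c t k → (c * (3 + k) + 4 * t) * (2 + k) ≡ c * ((3 + k) * (2 + k)) + 4 * t * (2 + k)
    expand = solve-∀
    collect : ∀ t k → 4 * t + 4 * t * (2 + k) ≡ 4 * (t * (3 + k))
    collect = solve-∀

probI≡ : ∀ A k → probI A (4 + k) ≡ frac (isolatedCount (choices A) k (suc k)) (length (prefixes (suc k)))
probI≡ A k = cong (λ c → frac c (length (prefixes (suc k))))
                  (countTrue-map (λ p → isolatedEvent (choices A) (nthD p) (4 + k)) (prefixes (suc k)))

probI-telescopes : ∀ A k → probI A (4 + k) ℚ.+ frac 4 (3 + k) ≡ frac 4 (2 + k)
probI-telescopes A k = trans (cong (ℚ._+ frac 4 (3 + k)) (probI≡ A k))
  (frac-telescope _ _ k (length-prefixes-pos (suc k)) (isolatedCount-ratio (choices A) k (suc k) (choices-admissible A (suc k)) ≤-refl))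

foldr-+-snoc : ∀ xs x → foldr ℚ._+_ 0ℚ (xs ++ [ x ]) ≡ foldr ℚ._+_ 0ℚ xs ℚ.+ x
foldr-+-snoc []       x = trans (ℚ.+-identityʳ x) (sym (ℚ.+-identityˡ x))
foldr-+-snoc (y ∷ xs) x = trans (cong (y ℚ.+_) (foldr-+-snoc xs x)) (sym (ℚ.+-assoc y _ x))

partialEY-suc : ∀ A N → partialEY A (suc N) ≡ partialEY A N ℚ.+ (if 4 ≤ᵇ suc N then probI A (suc N) else 0ℚ)
partialEY-suc A N = trans (cong (λ ns → foldr ℚ._+_ 0ℚ (map term ns)) (sym (upTo-∷ʳ (suc N))))
  (trans (cong (foldr ℚ._+_ 0ℚ) (map-++ term (upTo (suc N)) [ suc N ])) (foldr-+-snoc (map term (upTo (suc N))) (term (suc N))))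
  where
  term : ℕ → ℚ
  term n = if 4 ≤ᵇ n then probI A n else 0ℚ

partialEY-closed : ∀ A k → partialEY A (3 + k) ℚ.+ frac 4 (2 + k) ≡ + 2 / 1
partialEY-closed A zero    = refl
partialEY-closed A (suc k) = begin
  partialEY A (4 + k) ℚ.+ frac 4 (3 + k)                     ≡⟨ cong (ℚ._+ frac 4 (3 + k)) (partialEY-suc A (3 + k)) ⟩
  partialEY A (3 + k) ℚ.+ probI A (4 + k) ℚ.+ frac 4 (3 + k) ≡⟨ ℚ.+-assoc (partialEY A (3 + k)) (probI A (4 + k)) (frac 4 (3 + k)) ⟩
  partialEY A (3 + k) ℚ.+ (probI A (4 + k) ℚ.+ frac 4 (3 + k)) ≡⟨ cong (partialEY A (3 + k) ℚ.+_) (probI-telescopes A k) ⟩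
  partialEY A (3 + k) ℚ.+ frac 4 (2 + k)                     ≡⟨ partialEY-closed A k ⟩
  + 2 / 1                                                     ∎
  where open ≡-Reasoning

∣p-[p+r]∣ : ∀ p r → 0ℚ ≤ℚ r → ℚ.∣ p ℚ.- (p ℚ.+ r) ∣ ≡ r
∣p-[p+r]∣ p r 0≤r = trans (cong ℚ.∣_∣ p-[p+r]) (trans (ℚ.∣-p∣≡∣p∣ r) (ℚ.0≤p⇒∣p∣≡p 0≤r))
  where
  p-[p+r] : p ℚ.- (p ℚ.+ r) ≡ ℚ.- r
  p-[p+r] = trans (cong (p ℚ.+_) (ℚ.neg-distrib-+ p r)) (trans (sym (ℚ.+-assoc p (ℚ.- p) (ℚ.- r)))
              (trans (cong (ℚ._+ ℚ.- r) (ℚ.+-inverseʳ p)) (ℚ.+-identityˡ (ℚ.- r))))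

expectation-converges : ∀ (A : EvolvingCycle) ε → 0ℚ <ℚ ε →
  ∃[ N₀ ] ((N : ℕ) → N₀ ≤ N → ∣ partialEY A N - + 2 / 1 ∣ <ℚ ε)
expectation-converges A (ℚ.mkℚ (+ 0) _ _)      (ℚ.*<* (ℤ.+<+ ()))
expectation-converges A (ℚ.mkℚ ℤ.-[1+ _ ] _ _) (ℚ.*<* ())
expectation-converges A ε@(ℚ.mkℚ (+ suc p) q _) _ = 3 + 4 * suc q , close
  where
  close : ∀ N → 3 + 4 * suc q ≤ N → ∣ partialEY A N - + 2 / 1 ∣ <ℚ ε
  close N N₀≤N = subst (λ t → ∣ partialEY A t - + 2 / 1 ∣ <ℚ ε) N≡
    (subst (λ t → ∣ partialEY A (3 + k) - t ∣ <ℚ ε) (partialEY-closed A k)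
      (subst (_<ℚ ε) (sym (∣p-[p+r]∣ (partialEY A (3 + k)) (frac 4 (2 + k)) (frac-nonneg 4 (1 + k))))
        (frac-< 4 (1 + k) ε (suc p) q refl 4q<p[2+k])))
    where
    k = N ∸ 3
    N≡ : 3 + k ≡ N
    N≡ = m+[n∸m]≡n (≤-trans (m≤m+n 3 _) N₀≤N)
    4q<p[2+k] : 4 * suc q < suc p * (2 + k)
    4q<p[2+k] = ≤-trans (s≤s (≤-trans (∸-monoˡ-≤ 3 N₀≤N) (n≤1+n k))) (m≤n*m (2 + k) (suc p))

lemma1 : (A : EvolvingCycle) →
    -- E Y = 2 :  Σ_{n ≥ 4} Pr(I_n) converges to 2
    ((ε : ℚ) → 0ℚ <ℚ ε → ∃[ N₀ ] ((N : ℕ) → N₀ ≤ N → ∣ partialEY A N - + 2 / 1 ∣ <ℚ ε))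
    ×
    -- Pr(⋃_{n ≥ n₀} I_n) ≤ ε  (as the limit of the finite unions)
    ((ε : ℚ) (pos : 0ℚ <ℚ ε) (n₀ : ℕ) → threshold ε pos ≤ℚ + n₀ / 1 →
       (N : ℕ) → probUnion A n₀ N ≤ℚ ε)
lemma1 A = expectation-converges A , probUnion-bound A
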